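{- Let $k \geq 1$ be an integer and let $G$ be a $k$-connected graph with $n \geq 9$ vertices and $e$ edges, minimum degree $\delta$ and maximum degree $\Delta$. If $$M_1(G) \geq (n - k - 2)\Delta^2 + \frac{\bigl(e(\delta + n - k - 2)\bigr)^2}{4 \delta (n - k - 2)(k + 2)},$$ then $G$ is traceable or $G$ is the complete bipartite graph $K_{k,\, k+2}$.
   Context: All graphs are finite, undirected, without loops or multiple edges. For a graph $G$, $d_G(u)$ denotes the degree of a vertex $u$, $\delta$ and $\Delta$ denote the minimum and maximum degree of $G$, and the first Zagreb index is $M_1(G) = \sum_{u \in V(G)} d_G^2(u)$. A graph is traceable if it has a path containing all its vertices. $K_{a,b}$ denotes the complete bipartite graph with parts of sizes $a$ and $b$. -}

module Defs where

open import Data.Bool using (Bool; true; false; _xor_)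
open import Data.Nat as ℕ using (ℕ; zero; suc; _+_; _<ᵇ_; _⊔_; _⊓_)
open import Data.Fin using (Fin; toℕ)
open import Data.List using (List; []; _∷_; length; foldr; map; filter; allFin; concatMap)
open import Data.List.Membership.Propositional using (_∈_)
open import Data.List.Relation.Unary.Unique.Propositional using (Unique)
open import Data.List.Relation.Unary.All using (All)
open import Data.Product using (Σ; _×_; ∃)
open import Relation.Binary.PropositionalEquality using (_≡_)
open import Relation.Nullary using (¬_; yes; no)
open import Function.Bundles using (_↔_; Inverse)
open import Data.Rational as ℚ using (ℚ; 0ℚ)

record Graph (n : ℕ) : Set where
  field
    adj   : Fin n → Fin n → Bool
    sym   : ∀ u v → adj u v ≡ adj v u
    irrefl : ∀ u → adj u u ≡ false
open Graph public

count : ∀ {A : Set} → (A → Bool) → List A → ℕ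
count p []       = 0
count p (x ∷ xs) with p x
... | true  = suc (count p xs)
... | false = count p xs

deg : ∀ {n} → Graph n → Fin n → ℕ
deg G u = count (adj G u) (allFin _)

edges : ∀ {n} → Graph n → ℕ
edges {n} G = foldr _+_ 0
  (map (λ u → count (λ v → (toℕ u <ᵇ toℕ v) Data.Bool.∧ adj G u v) (allFin n)) (allFin n))

maxDeg : ∀ {n} → Graph n → ℕ
maxDeg {n} G = foldr _⊔_ 0 (map (deg G) (allFin n))

-- minimum degree δ (the seed n exceeds every degree, so for n ≥ 1
-- this is the true minimum)
minDeg : ∀ {n} → Graph n → ℕ
minDeg {n} G = foldr _⊓_ n (map (deg G) (allFin n))

M₁ : ∀ {n} → Graph n → ℕ
M₁ {n} G = foldr _+_ 0 (map (λ u → deg G u ℕ.* deg G u) (allFin n))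

IsWalk : ∀ {n} → Graph n → List (Fin n) → Set
IsWalk G []           = Data.Unit.⊤
  where import Data.Unit
IsWalk G (x ∷ [])     = Data.Unit.⊤
  where import Data.Unit
IsWalk G (x ∷ y ∷ xs) = (adj G x y ≡ true) × IsWalk G (y ∷ xs)

data StartsAt {n} (u : Fin n) : List (Fin n) → Set where
  here : ∀ {xs} → StartsAt u (u ∷ xs)

data EndsAt {n} (v : Fin n) : List (Fin n) → Set where
  single : EndsAt v (v ∷ [])
  there  : ∀ {x xs} → EndsAt v xs → EndsAt v (x ∷ xs)

ConnectedAvoiding : ∀ {n} → Graph n → List (Fin n) → Set
ConnectedAvoiding {n} G S =
  ∀ u v → ¬ (u ∈ S) → ¬ (v ∈ S) →
  Σ (List (Fin n)) λ w → IsWalk G w × StartsAt u w × EndsAt v w × All (λ x → ¬ (x ∈ S)) w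

KConnected : ∀ {n} → ℕ → Graph n → Set
KConnected {n} k G =
  (k ℕ.< n) × (∀ (S : List (Fin n)) → Unique S → length S ℕ.< k → ConnectedAvoiding G S)

Traceable : ∀ {n} → Graph n → Set
Traceable {n} G = Σ (List (Fin n)) λ p → IsWalk G p × Unique p × length p ≡ n

K : (a b : ℕ) → Graph (a + b)
K a b = record
  { adj    = λ i j → (toℕ i <ᵇ a) xor (toℕ j <ᵇ a)
  ; sym    = λ i j → xor-comm (toℕ i <ᵇ a) (toℕ j <ᵇ a)
  ; irrefl = λ i → xor-self (toℕ i <ᵇ a)
  }
  where
  xor-comm : ∀ x y → (x xor y) ≡ (y xor x)
  xor-comm true true = Relation.Binary.PropositionalEquality.refl
  xor-comm true false = Relation.Binary.PropositionalEquality.refl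
  xor-comm false true = Relation.Binary.PropositionalEquality.refl
  xor-comm false false = Relation.Binary.PropositionalEquality.refl
  xor-self : ∀ x → (x xor x) ≡ false
  xor-self true = Relation.Binary.PropositionalEquality.refl
  xor-self false = Relation.Binary.PropositionalEquality.refl

_≅_ : ∀ {n m} → Graph n → Graph m → Set
_≅_ {n} {m} G H = Σ (Fin n ↔ Fin m) λ f →
  ∀ u v → adj H (Inverse.to f u) (Inverse.to f v) ≡ adj G u v

-- total division on ℚ with the convention x / 0 = 0
_÷₀_ : ℚ → ℚ → ℚ
p ÷₀ q with q ℚ.≟ 0ℚ
... | yes _  = 0ℚ
... | no q≢0 = ℚ._÷_ p q {{ℚ.≢-nonZero q≢0}}

ι : ℕ → ℚ
ι m = ℚ.mkℚ+ m 1 (Data.Nat.Coprimality.sym (Data.Nat.Coprimality.1-coprimeTo m))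
  where import Data.Nat.Coprimality

module Submission where

-- Let P be a longest path of G missing some vertex h. The vertices of P adjacent to the
-- component H of G − P containing h separate h from the first vertex v₁ of P, so there are at
-- least k of them; their successors on P, together with h and v₁, form an independent set I
-- with |I| ≥ k + 2, since any edge among them would yield a longer path. Take |I| = k + 2 and let
-- J be the other D = n − k − 2 vertices. Degrees in I lie in [δ, D], so d² ≤ (δ + D)d − δD
-- there, and Σ_J d² ≤ DΔ²; with e(I, J) ≤ e and AM–GM this gives
--   M₁ ≤ DΔ² + (e(δ + D))² / (4δD(k + 2)).
-- Under the hypothesis every step is tight: J is independent, J-degrees equal Δ, I-degrees are
-- δ or D, and (δ + D)Δ = 2(k + 2)δ. Then D ≤ Δ ≤ k + 2, and with k ≤ δ ≤ D this forces δ = D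
-- once n ≥ 9, so G = K_{k+2,D} with k ≤ D ≤ k + 2, which is traceable unless D = k.

open import Defs hiding (sym)

module _ where

  open import Axiom.UniquenessOfIdentityProofs using (module Decidable⇒UIP)
  open import Data.Bool using (Bool; true; false; not; _∧_; _xor_; if_then_else_)
  open import Data.Bool.Properties using (¬-not; not-injective; not-involutive; T-≡) renaming (_≟_ to _≟ᵇ_)
  open import Data.Empty using (⊥; ⊥-elim)
  open import Data.Fin using (Fin; toℕ; cast)
  import Data.Fin as Fin
  open import Data.Fin.Properties
    using (any?; toℕ-injective; toℕ-cast; cast-involutive; toℕ<n) renaming (_≟_ to _≟ᶠ_)
  import Data.Integer as ℤ
  import Data.Integer.Properties as ℤ
  open import Data.List using (List; []; _∷_; [_]; length; allFin; foldr; map; filter; take; lookup; _++_; reverse)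
  open import Data.List.Properties
    using (length-tabulate; length-take; length-++; unfold-reverse; reverse-++; ++-assoc)
  open import Data.List.Membership.Propositional using (_∈_; _∉_)
  open import Data.List.Membership.Propositional.Properties
    using (∈-∃++; ∈-++⁻; ∈-++⁺ˡ; ∈-++⁺ʳ; ∈-filter⁺; ∈-filter⁻; ∈-allFin; ∈-map⁺; ∈-map⁻; ∈-lookup)
  import Data.List.Membership.DecPropositional as DecMembership
  import Data.List.Membership.Setoid.Properties as SetoidMembership
  open import Data.List.Relation.Unary.Any using (here; there; index)
  open import Data.List.Relation.Unary.Any.Properties using (lookup-index)
  open import Data.List.Relation.Unary.All as All using (All; []; _∷_; all?)
  open import Data.List.Relation.Unary.All.Properties using (¬Any⇒All¬; All¬⇒¬Any)
  open import Data.List.Relation.Unary.AllPairs as AllPairs using (AllPairs; []; _∷_; allPairs?)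
  import Data.List.Relation.Unary.AllPairs.Properties as AllPairsₚ
  open import Data.List.Relation.Unary.Unique.Propositional using (Unique)
  open import Data.List.Relation.Unary.Unique.Propositional.Properties using (allFin⁺; filter⁺; take⁺; ++⁺)
  open import Data.List.Relation.Binary.Permutation.Propositional
    using (_↭_; ↭-refl; ↭-sym; ↭-trans; prep; ↭⇒↭ₛ)
  open import Data.List.Relation.Binary.Permutation.Propositional.Properties
    using (∈-resp-↭; ++-comm; shift; shifts; ↭-reverse; ↭-length; ++⁺ˡ; ++⁺ʳ)
  import Data.List.Relation.Binary.Permutation.Setoid.Properties as PermutationSetoid
  open import Data.Nat
    using ( ℕ; zero; suc; _+_; _*_; _≤_; _<_; _≥_; z≤n; s≤s; _⊔_; _⊓_; _<ᵇ_; _≤?_; _≟_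
          ; NonZero; >-nonZero; >-nonZero⁻¹)
  open import Data.Nat.Properties
  open import Data.Nat.Tactic.RingSolver using (solve-∀)
  open import Data.Product using (∃; ∃-syntax; _×_; _,_; proj₁; proj₂)
  import Data.Rational as ℚ
  import Data.Rational.Properties as ℚ
  import Data.Rational.Unnormalised as ℚᵘ
  import Data.Rational.Unnormalised.Properties as ℚᵘ
  open import Data.Rational.Solver using (module +-*-Solver)
  open import Data.Sum using (_⊎_; inj₁; inj₂)
  open import Data.Unit using (tt)
  open import Function using (_∘_; id; Equivalence; mk↔ₛ′)
  open import Relation.Binary using (tri<; tri≈; tri>)
  open import Relation.Binary.PropositionalEquality hiding ([_]; J)
  open import Relation.Nullary using (¬_; Dec; yes; no; does)
  open import Relation.Nullary.Decidable using (map′; _×-dec_; ¬?; dec-true; decidable-stable)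

  private variable
    A B : Set

  𝟙 : Bool → ℕ
  𝟙 true  = 1
  𝟙 false = 0

  𝟙≤1 : ∀ b → 𝟙 b ≤ 1
  𝟙≤1 true  = ≤-refl
  𝟙≤1 false = z≤n

  ∑ : (A → ℕ) → List A → ℕ
  ∑ f []       = 0
  ∑ f (x ∷ xs) = f x + ∑ f xs

  foldr-map≡∑ : ∀ (f : A → ℕ) xs → foldr _+_ 0 (map f xs) ≡ ∑ f xs
  foldr-map≡∑ f []       = refl
  foldr-map≡∑ f (x ∷ xs) = cong (f x +_) (foldr-map≡∑ f xs)

  count≡∑𝟙 : ∀ (p : A → Bool) xs → count p xs ≡ ∑ (𝟙 ∘ p) xs
  count≡∑𝟙 p []       = refl
  count≡∑𝟙 p (x ∷ xs) with p x
  ... | true  = cong suc (count≡∑𝟙 p xs)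
  ... | false = count≡∑𝟙 p xs

  ∑-cong : ∀ {f g : A → ℕ} xs → (∀ {x} → x ∈ xs → f x ≡ g x) → ∑ f xs ≡ ∑ g xs
  ∑-cong []       f≡g = refl
  ∑-cong (x ∷ xs) f≡g = cong₂ _+_ (f≡g (here refl)) (∑-cong xs (f≡g ∘ there))

  ∑-+ : ∀ (f g : A → ℕ) xs → ∑ (λ x → f x + g x) xs ≡ ∑ f xs + ∑ g xs
  ∑-+ f g []       = refl
  ∑-+ f g (x ∷ xs) = begin
    f x + g x + ∑ (λ x → f x + g x) xs ≡⟨ cong (f x + g x +_) (∑-+ f g xs) ⟩
    f x + g x + (∑ f xs + ∑ g xs)      ≡⟨ +-exchange (f x) (g x) (∑ f xs) (∑ g xs) ⟩
    f x + ∑ f xs + (g x + ∑ g xs)      ∎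
    where
    open ≡-Reasoning
    +-exchange : ∀ a b c d → a + b + (c + d) ≡ a + c + (b + d)
    +-exchange = solve-∀

  ∑-*ˡ : ∀ c (f : A → ℕ) xs → ∑ (λ x → c * f x) xs ≡ c * ∑ f xs
  ∑-*ˡ c f []       = sym (*-zeroʳ c)
  ∑-*ˡ c f (x ∷ xs) = trans (cong (c * f x +_) (∑-*ˡ c f xs)) (sym (*-distribˡ-+ c (f x) (∑ f xs)))

  ∑-const : ∀ c (xs : List A) → ∑ (λ _ → c) xs ≡ length xs * c
  ∑-const c []       = refl
  ∑-const c (x ∷ xs) = cong (c +_) (∑-const c xs)

  ∑-comm : ∀ (f : A → B → ℕ) xs ys →
           ∑ (λ x → ∑ (f x) ys) xs ≡ ∑ (λ y → ∑ (λ x → f x y) xs) ys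
  ∑-comm f [] ys = sym (trans (∑-const 0 ys) (*-zeroʳ (length ys)))
  ∑-comm f (x ∷ xs) ys = trans (cong (∑ (f x) ys +_) (∑-comm f xs ys))
                               (sym (∑-+ (f x) (λ y → ∑ (λ x → f x y) xs) ys))

  ∑-mono-≤ : ∀ {f g : A → ℕ} xs → (∀ {x} → x ∈ xs → f x ≤ g x) → ∑ f xs ≤ ∑ g xs
  ∑-mono-≤ []       f≤g = z≤n
  ∑-mono-≤ (x ∷ xs) f≤g = +-mono-≤ (f≤g (here refl)) (∑-mono-≤ xs (f≤g ∘ there))

  ∑-mono-≤-tight : ∀ {f g : A → ℕ} xs → (∀ {x} → x ∈ xs → f x ≤ g x) → ∑ g xs ≤ ∑ f xs →
                   ∀ {x} → x ∈ xs → f x ≡ g x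
  ∑-mono-≤-tight {f = f} {g} (x ∷ xs) f≤g tight (here refl) =
    ≤-antisym (f≤g (here refl)) (+-cancelʳ-≤ (∑ g xs) (g x) (f x)
      (≤-trans tight (+-monoʳ-≤ (f x) (∑-mono-≤ xs (f≤g ∘ there)))))
  ∑-mono-≤-tight {f = f} {g} (x ∷ xs) f≤g tight (there x∈xs) =
    ∑-mono-≤-tight xs (f≤g ∘ there) (+-cancelˡ-≤ (g x) (∑ g xs) (∑ f xs)
      (≤-trans tight (+-monoˡ-≤ (∑ f xs) (f≤g (here refl))))) x∈xs

  ∑≡0⇒≡0 : ∀ (f : A → ℕ) xs → ∑ f xs ≡ 0 → ∀ {x} → x ∈ xs → f x ≡ 0
  ∑≡0⇒≡0 f (x ∷ xs) ∑≡0 (here refl)  = m+n≡0⇒m≡0 (f x) ∑≡0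
  ∑≡0⇒≡0 f (x ∷ xs) ∑≡0 (there x∈xs) = ∑≡0⇒≡0 f xs (m+n≡0⇒n≡0 (f x) ∑≡0) x∈xs

  count+count-not : ∀ (p : A → Bool) xs → count p xs + count (not ∘ p) xs ≡ length xs
  count+count-not p [] = refl
  count+count-not p (x ∷ xs) with p x
  ... | true  = cong suc (count+count-not p xs)
  ... | false = trans (+-suc _ _) (cong suc (count+count-not p xs))

  filterᵗ : (A → Bool) → List A → List A
  filterᵗ p = filter (λ x → p x ≟ᵇ true)

  length-filterᵗ : ∀ (p : A → Bool) xs → length (filterᵗ p xs) ≡ count p xs
  length-filterᵗ p [] = refl
  length-filterᵗ p (x ∷ xs) with p x
  ... | true  = cong suc (length-filterᵗ p xs)
  ... | false = length-filterᵗ p xs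

  ∈-filterᵗ⁺ : ∀ (p : A → Bool) {xs x} → x ∈ xs → p x ≡ true → x ∈ filterᵗ p xs
  ∈-filterᵗ⁺ p = ∈-filter⁺ (λ x → p x ≟ᵇ true)

  ∈-filterᵗ⁻ : ∀ (p : A → Bool) {xs x} → x ∈ filterᵗ p xs → x ∈ xs × p x ≡ true
  ∈-filterᵗ⁻ p = ∈-filter⁻ (λ x → p x ≟ᵇ true)

  filterᵗ-unique : ∀ (p : A → Bool) {xs} → Unique xs → Unique (filterᵗ p xs)
  filterᵗ-unique p = filter⁺ (λ x → p x ≟ᵇ true)

  ∑-filterᵗ : ∀ (p : A → Bool) (f : A → ℕ) xs →
              ∑ f xs ≡ ∑ f (filterᵗ p xs) + ∑ f (filterᵗ (not ∘ p) xs)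
  ∑-filterᵗ p f [] = refl
  ∑-filterᵗ p f (x ∷ xs) with p x
  ... | true  = trans (cong (f x +_) (∑-filterᵗ p f xs)) (sym (+-assoc (f x) _ _))
  ... | false = trans (cong (f x +_) (∑-filterᵗ p f xs))
                  (+-comm-middle (f x) (∑ f (filterᵗ p xs)) (∑ f (filterᵗ (not ∘ p) xs)))
    where
    +-comm-middle : ∀ a b c → a + (b + c) ≡ b + (a + c)
    +-comm-middle = solve-∀

  unique⊆⇒length≤ : ∀ {xs ys : List A} → Unique xs → (∀ {z} → z ∈ xs → z ∈ ys) →
                    length xs ≤ length ys
  unique⊆⇒length≤ {xs = []}     _            _  = z≤n
  unique⊆⇒length≤ {xs = x ∷ xs} (x∉xs ∷ !xs) xs⊆ys with ∈-∃++ (xs⊆ys (here refl))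
  ... | as , bs , refl = subst (suc (length xs) ≤_) (length-insert as)
                           (s≤s (unique⊆⇒length≤ !xs xs⊆as++bs))
    where
    length-insert : ∀ as → suc (length (as ++ bs)) ≡ length (as ++ x ∷ bs)
    length-insert []       = refl
    length-insert (a ∷ as) = cong suc (length-insert as)
    xs⊆as++bs : ∀ {z} → z ∈ xs → z ∈ as ++ bs
    xs⊆as++bs z∈xs with ∈-++⁻ as (xs⊆ys (there z∈xs))
    ... | inj₁ z∈as          = ∈-++⁺ˡ z∈as
    ... | inj₂ (here refl)   = ⊥-elim (All¬⇒¬Any x∉xs z∈xs)
    ... | inj₂ (there z∈bs) = ∈-++⁺ʳ as z∈bs

  interleave : List A → List A → List A
  interleave []       ys = ys
  interleave (x ∷ xs) ys = x ∷ interleave ys xs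

  length-allFin : ∀ n → length (allFin n) ≡ n
  length-allFin n = length-tabulate id

  unique⇒length≤n : ∀ {n} {xs : List (Fin n)} → Unique xs → length xs ≤ n
  unique⇒length≤n {n} {xs} !xs =
    subst (length xs ≤_) (length-allFin n) (unique⊆⇒length≤ !xs (λ {z} _ → ∈-allFin z))

  Unique-resp-↭ : ∀ {A : Set} {xs ys : List A} → xs ↭ ys → Unique xs → Unique ys
  Unique-resp-↭ {A} xs↭ys = PermutationSetoid.Unique-resp-↭ (setoid A) (↭⇒↭ₛ xs↭ys)

  any-of-length? : ∀ {n} L (Q : List (Fin n) → Set) → (∀ xs → Dec (Q xs)) →
                   Dec (∃ λ xs → length xs ≡ L × Q xs)
  any-of-length? zero Q Q? with Q? []
  ... | yes q  = yes ([] , refl , q)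
  ... | no ¬q = no λ { ([] , _ , q) → ¬q q }
  any-of-length? (suc L) Q Q? =
    map′ (λ (x , xs , len , q) → x ∷ xs , cong suc len , q)
         (λ { (x ∷ xs , len , q) → x , xs , suc-injective len , q })
         (any? λ x → any-of-length? L (Q ∘ (x ∷_)) (Q? ∘ (x ∷_)))

  any-of-length≤? : ∀ {n} L (Q : List (Fin n) → Set) → (∀ xs → Dec (Q xs)) →
                    Dec (∃ λ xs → length xs ≤ L × Q xs)
  any-of-length≤? zero Q Q? =
    map′ (λ (xs , len , q) → xs , ≤-reflexive len , q)
         (λ (xs , len , q) → xs , n≤0⇒n≡0 len , q)
         (any-of-length? 0 Q Q?)
  any-of-length≤? (suc L) Q Q? with any-of-length? (suc L) Q Q? | any-of-length≤? L Q Q?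
  ... | yes (xs , len , q) | _                   = yes (xs , ≤-reflexive len , q)
  ... | no _               | yes (xs , len , q) = yes (xs , m≤n⇒m≤1+n len , q)
  ... | no ¬= | no ¬< = no λ (xs , len , q) → case xs len q
    where
    case : ∀ xs → length xs ≤ suc L → Q xs → ⊥
    case xs len q with m≤n⇒m<n∨m≡n len
    ... | inj₁ len< = ¬< (xs , ≤-pred len< , q)
    ... | inj₂ len≡ = ¬= (xs , len≡ , q)

  EndsAt⇒∃ : ∀ {n} {v : Fin n} {w} → EndsAt v w → ∃ λ w′ → w ≡ w′ ++ [ v ]
  EndsAt⇒∃ single = [] , refl
  EndsAt⇒∃ (there {x} end) with EndsAt⇒∃ end
  ... | w′ , refl = x ∷ w′ , refl

  EndsAt-++ : ∀ {n} (v : Fin n) w → EndsAt v (w ++ [ v ])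
  EndsAt-++ v []      = single
  EndsAt-++ v (x ∷ w) = there (EndsAt-++ v w)

  EndsAt-++ˡ : ∀ {n} {v : Fin n} ws {w} → EndsAt v w → EndsAt v (ws ++ w)
  EndsAt-++ˡ []       end = end
  EndsAt-++ˡ (x ∷ ws) end = there (EndsAt-++ˡ ws end)

  EndsAt-++ʳ : ∀ {n} {v : Fin n} ws {x w} → EndsAt v (ws ++ x ∷ w) → EndsAt v (x ∷ w)
  EndsAt-++ʳ []           end         = end
  EndsAt-++ʳ (_ ∷ [])     (there end) = end
  EndsAt-++ʳ (_ ∷ y ∷ ws) (there end) = EndsAt-++ʳ (y ∷ ws) end

  EndsAt⇒∈ : ∀ {n} {v : Fin n} {w} → EndsAt v w → v ∈ w
  EndsAt⇒∈ single      = here refl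
  EndsAt⇒∈ (there end) = there (EndsAt⇒∈ end)

  EndsAt? : ∀ {n} (v : Fin n) w → Dec (EndsAt v w)
  EndsAt? v [] = no λ ()
  EndsAt? v (x ∷ []) with x ≟ᶠ v
  ... | yes refl = yes single
  ... | no x≢v   = no λ { single → x≢v refl ; (there ()) }
  EndsAt? v (x ∷ y ∷ w) =
    map′ there (λ { (there end) → end }) (EndsAt? v (y ∷ w))

  unique? : ∀ {n} (xs : List (Fin n)) → Dec (Unique xs)
  unique? = allPairs? λ x y → ¬? (x ≟ᶠ y)

  module _ {n : ℕ} (G : Graph n) where

    IsPath : List (Fin n) → Set
    IsPath p = IsWalk G p × Unique p

    IsWalk-tail : ∀ {x xs} → IsWalk G (x ∷ xs) → IsWalk G xs
    IsWalk-tail {xs = []}    _         = tt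
    IsWalk-tail {xs = _ ∷ _} (_ , walk) = walk

    IsWalk-split : ∀ xs a ys → IsWalk G (xs ++ a ∷ ys) → IsWalk G (xs ++ [ a ]) × IsWalk G (a ∷ ys)
    IsWalk-split []           a ys walk       = tt , walk
    IsWalk-split (x ∷ [])     a ys (e , walk) = (e , tt) , walk
    IsWalk-split (x ∷ y ∷ xs) a ys (e , walk) with IsWalk-split (y ∷ xs) a ys walk
    ... | walk₁ , walk₂ = (e , walk₁) , walk₂

    IsWalk-join : ∀ xs a ys → IsWalk G (xs ++ [ a ]) → IsWalk G (a ∷ ys) → IsWalk G (xs ++ a ∷ ys)
    IsWalk-join []           a ys _           walk₂ = walk₂
    IsWalk-join (x ∷ [])     a ys (e , _)     walk₂ = e , walk₂
    IsWalk-join (x ∷ y ∷ xs) a ys (e , walk₁) walk₂ = e , IsWalk-join (y ∷ xs) a ys walk₁ walk₂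

    IsWalk-snoc : ∀ xs a b → IsWalk G (xs ++ [ a ]) → adj G a b ≡ true → IsWalk G (xs ++ a ∷ [ b ])
    IsWalk-snoc xs a b walk e = IsWalk-join xs a [ b ] walk (e , tt)

    IsWalk-reverse : ∀ xs → IsWalk G xs → IsWalk G (reverse xs)
    IsWalk-reverse []           _          = tt
    IsWalk-reverse (x ∷ [])     _          = tt
    IsWalk-reverse (x ∷ y ∷ xs) (e , walk) =
      subst (IsWalk G) (sym (unfold-reverse x (y ∷ xs)))
        (subst (λ z → IsWalk G (z ++ [ x ])) (sym (unfold-reverse y xs))
          (subst (IsWalk G) (sym (++-assoc (reverse xs) [ y ] [ x ]))
            (IsWalk-snoc (reverse xs) y x
              (subst (IsWalk G) (unfold-reverse y xs) (IsWalk-reverse (y ∷ xs) walk))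
              (trans (Graph.sym G y x) e))))

    IsWalk? : ∀ xs → Dec (IsWalk G xs)
    IsWalk? []           = yes tt
    IsWalk? (x ∷ [])     = yes tt
    IsWalk? (x ∷ y ∷ xs) = (adj G x y ≟ᵇ true) ×-dec IsWalk? (y ∷ xs)

    IsPath? : ∀ xs → Dec (IsPath xs)
    IsPath? xs = IsWalk? xs ×-dec unique? xs

    IsLongest : List (Fin n) → Set
    IsLongest p = ∀ q → IsPath q → length q ≤ length p

    longestPath : ∃ λ p → IsPath p × IsLongest p
    longestPath = search n (λ q path → unique⇒length≤n (proj₂ path))
      where
      search : ∀ L → (∀ q → IsPath q → length q ≤ L) → ∃ λ p → IsPath p × IsLongest p
      search zero    bound = [] , (tt , []) , bound
      search (suc L) bound with any-of-length? (suc L) IsPath IsPath?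
      ... | yes (p , len , path) = p , path , λ q path′ → subst (length q ≤_) (sym len) (bound q path′)
      ... | no ¬path = search L λ q path →
        ≤-pred (≤∧≢⇒< (bound q path) (λ len → ¬path (q , len , path)))

    walk⇒path : ∀ {v} u ws → IsWalk G (u ∷ ws) → EndsAt v (u ∷ ws) →
                ∃ λ p → IsPath (u ∷ p) × EndsAt v (u ∷ p) × (∀ {z} → z ∈ u ∷ p → z ∈ u ∷ ws)
    walk⇒path u [] _ single = [] , (tt , [] ∷ []) , single , id
    walk⇒path {v} u (b ∷ ws) (e , walk) (there end) with walk⇒path b ws walk end
    ... | p , (walk′ , !p) , end′ , p⊆ws with u ∈? (b ∷ p)
      where open DecMembership _≟ᶠ_
    ... | no u∉p = b ∷ p , ((e , walk′) , ¬Any⇒All¬ _ u∉p ∷ !p) , there end′ , ⊆-prep p⊆ws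
      where
      ⊆-prep : (∀ {z} → z ∈ b ∷ p → z ∈ b ∷ ws) → ∀ {z} → z ∈ u ∷ b ∷ p → z ∈ u ∷ b ∷ ws
      ⊆-prep _   (here refl) = here refl
      ⊆-prep sub (there z∈)  = there (sub z∈)
    ... | yes u∈p with ∈-∃++ u∈p
    ... | as , bs , eq = bs , (walk″ , !bs) , EndsAt-++ʳ as (subst (EndsAt v) eq end′) , ⊆-cut
      where
      walk″ : IsWalk G (u ∷ bs)
      walk″ = proj₂ (IsWalk-split as u bs (subst (IsWalk G) eq walk′))
      !bs : Unique (u ∷ bs)
      !bs = unique-suffix as (subst Unique eq !p)
        where
        unique-suffix : ∀ xs {ys} → Unique (xs ++ ys) → Unique ys
        unique-suffix []       !ys       = !ys
        unique-suffix (x ∷ xs) (_ ∷ !ys) = unique-suffix xs !ys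
      ⊆-cut : ∀ {z} → z ∈ u ∷ bs → z ∈ u ∷ b ∷ ws
      ⊆-cut (here refl) = here refl
      ⊆-cut (there z∈)  = there (p⊆ws (subst (_ ∈_) (sym eq) (∈-++⁺ʳ as (there z∈))))

    IsWalk-detour : ∀ u x q t ys {y} → adj G u x ≡ true → IsWalk G (x ∷ q) → EndsAt y (x ∷ q) →
                    adj G y t ≡ true → IsWalk G (t ∷ ys) → IsWalk G (u ∷ x ∷ q ++ t ∷ ys)
    IsWalk-detour u x q t ys {y} ux walk end yt walk′ with EndsAt⇒∃ end
    ... | c , eq =
      subst (λ z → IsWalk G (u ∷ z)) (sym (trans (cong (_++ t ∷ ys) eq) (++-assoc c [ y ] (t ∷ ys))))
        (IsWalk-join (u ∷ c) y (t ∷ ys) (subst (λ z → IsWalk G (u ∷ z)) eq (ux , walk)) (yt , walk′))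

    IndependentList : List (Fin n) → Set
    IndependentList = AllPairs λ u v → adj G u v ≡ false

  does≡true⇒ : ∀ {A : Set} (a? : Dec A) → does a? ≡ true → A
  does≡true⇒ (yes a) _ = a

  module LongestPath {n : ℕ} (G : Graph n) {P : List (Fin n)}
                     (path : IsPath G P) (longest : IsLongest G P)
                     {h : Fin n} (h∉P : h ∉ P) where

    open DecMembership (_≟ᶠ_ {n}) using (_∈?_)

    OffPath : List (Fin n) → Set
    OffPath = All (_∉ P)

    Reachable : Fin n → Set
    Reachable x = ∃ λ w → IsWalk G (h ∷ w) × EndsAt x (h ∷ w) × OffPath (h ∷ w)

    reachable⇒∉P : ∀ {x} → Reachable x → x ∉ P
    reachable⇒∉P (_ , _ , end , off) = All.lookup off (EndsAt⇒∈ end)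

    reachable-h : Reachable h
    reachable-h = [] , tt , single , h∉P ∷ []

    Reachable? : ∀ x → Dec (Reachable x)
    Reachable? x with any-of-length≤? n Reachable-by Reachable-by?
      where
      Reachable-by : List (Fin n) → Set
      Reachable-by w = IsWalk G (h ∷ w) × EndsAt x (h ∷ w) × OffPath (h ∷ w)
      Reachable-by? : ∀ w → Dec (Reachable-by w)
      Reachable-by? w = IsWalk? G (h ∷ w) ×-dec (EndsAt? x (h ∷ w) ×-dec all? (λ z → ¬? (z ∈? P)) (h ∷ w))
    ... | yes (w , _ , reach) = yes (w , reach)
    ... | no ¬reach = no λ (w , walk , end , off) → shortcut w walk end off
      where
      shortcut : ∀ w → IsWalk G (h ∷ w) → EndsAt x (h ∷ w) → OffPath (h ∷ w) → ⊥
      shortcut w walk end off with walk⇒path G h w walk end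
      ... | p , (walk′ , !p) , end′ , p⊆w =
        ¬reach (p , ≤-pred (m≤n⇒m≤1+n (unique⇒length≤n !p)) , walk′ , end′ ,
                All.tabulate (All.lookup off ∘ p⊆w))

    Attached : Fin n → Set
    Attached u = ∃ λ x → Reachable x × adj G u x ≡ true

    Attached? : ∀ u → Dec (Attached u)
    Attached? u = any? λ x → Reachable? x ×-dec (adj G u x ≟ᵇ true)

    attached : Fin n → Bool
    attached u = does (Attached? u)

    attached⁺ : ∀ {u} → Attached u → attached u ≡ true
    attached⁺ {u} = dec-true (Attached? u)

    attached⁻ : ∀ {u} → attached u ≡ true → Attached u
    attached⁻ {u} = does≡true⇒ (Attached? u)

    Detour : Fin n → Fin n → Set
    Detour x y = ∃ λ q → IsPath G (x ∷ q) × EndsAt y (x ∷ q) × OffPath (x ∷ q)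

    -- Glue the walks from h to x and to y at h, then shorten to a path.
    detour : ∀ {x y} → Reachable x → Reachable y → Detour x y
    detour {x} {y} (w₁ , walk₁ , end₁ , off₁) (w₂ , walk₂ , end₂ , off₂) with EndsAt⇒∃ end₁
    ... | a , h∷w₁≡a++x with walk⇒path G x (reverse a ++ w₂) walk end
      where
      joined≡ : reverse w₁ ++ h ∷ w₂ ≡ x ∷ reverse a ++ w₂
      joined≡ = begin
        reverse w₁ ++ h ∷ w₂        ≡⟨ ++-assoc (reverse w₁) [ h ] w₂ ⟨
        (reverse w₁ ++ [ h ]) ++ w₂ ≡⟨ cong (_++ w₂) (unfold-reverse h w₁) ⟨
        reverse (h ∷ w₁) ++ w₂     ≡⟨ cong (λ z → reverse z ++ w₂) h∷w₁≡a++x ⟩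
        reverse (a ++ [ x ]) ++ w₂  ≡⟨ cong (_++ w₂) (reverse-++ a [ x ]) ⟩
        x ∷ reverse a ++ w₂         ∎
        where open ≡-Reasoning
      walk : IsWalk G (x ∷ reverse a ++ w₂)
      walk = subst (IsWalk G) joined≡ (IsWalk-join G (reverse w₁) h w₂
               (subst (IsWalk G) (unfold-reverse h w₁) (IsWalk-reverse G (h ∷ w₁) walk₁)) walk₂)
      end : EndsAt y (x ∷ reverse a ++ w₂)
      end = subst (EndsAt y) joined≡ (EndsAt-++ˡ (reverse w₁) end₂)
    ... | q , path , end , q⊆ = q , path , end , All.tabulate (off ∘ q⊆)
      where
      off : ∀ {z} → z ∈ x ∷ reverse a ++ w₂ → z ∉ P
      off (here refl) = reachable⇒∉P (w₁ , walk₁ , end₁ , off₁)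
      off (there z∈) with ∈-++⁻ (reverse a) z∈
      ... | inj₁ z∈a  = All.lookup off₁ (subst (_ ∈_) (sym h∷w₁≡a++x)
                          (∈-++⁺ˡ (∈-resp-↭ (↭-reverse a) z∈a)))
      ... | inj₂ z∈w₂ = All.lookup off₂ (there z∈w₂)

    module _ {L : List (Fin n)} (P≡L : P ≡ L) where

      pathL : IsPath G L
      pathL = subst (IsPath G) P≡L path

      ∉L : ∀ {z} → z ∉ P → z ∉ L
      ∉L z∉P z∈L = z∉P (subst (_ ∈_) (sym P≡L) z∈L)

      no-longer-path : ∀ q → IsPath G q → length L < length q → ⊥
      no-longer-path q path′ len< =
        <-irrefl refl (<-≤-trans len< (subst (λ z → length q ≤ length z) P≡L (longest q path′)))

      -- A walk through all of P and some vertices off P would be a longer path.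
      no-longer-walk : ∀ {x} q → Unique (x ∷ q) → OffPath (x ∷ q) →
                       ∀ new → new ↭ (x ∷ q) ++ L → ¬ IsWalk G new
      no-longer-walk {x} q !q off new new↭ walk =
        no-longer-path new (walk , Unique-resp-↭ (↭-sym new↭) (++⁺ !q (proj₂ pathL) disjoint)) len<
        where
        disjoint : ∀ {z} → ¬ (z ∈ x ∷ q × z ∈ L)
        disjoint (z∈q , z∈L) = ∉L (All.lookup off z∈q) z∈L
        len< : length L < length new
        len< = subst (length L <_) (sym (trans (↭-length new↭) (length-++ (x ∷ q))))
                 (m<n+m (length L) (s≤s z≤n))

      no-longer-walk₁ : ∀ {x} → Reachable x → ∀ new → new ↭ x ∷ L → ¬ IsWalk G new
      no-longer-walk₁ reach = no-longer-walk [] ([] ∷ []) (reachable⇒∉P reach ∷ [])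

    ¬Attached-first : ∀ {v₁ ps} → P ≡ v₁ ∷ ps → ¬ Attached v₁
    ¬Attached-first {v₁} {ps} P≡ (x , reach , v₁x) =
      no-longer-walk₁ P≡ reach (x ∷ v₁ ∷ ps) ↭-refl (trans (Graph.sym G x v₁) v₁x , proj₁ (pathL P≡))

    ¬Attached-last : ∀ {ps vₗ} → P ≡ ps ++ [ vₗ ] → ¬ Attached vₗ
    ¬Attached-last {ps} {vₗ} P≡ (x , reach , vₗx) =
      no-longer-walk₁ P≡ reach ((ps ++ [ vₗ ]) ++ [ x ]) (++-comm (ps ++ [ vₗ ]) [ x ])
        (subst (IsWalk G) (sym (++-assoc ps [ vₗ ] [ x ])) (IsWalk-snoc G ps vₗ x (proj₁ (pathL P≡)) vₗx))

    -- Replace the edge u t of P by a detour u x … y t through the component.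
    ¬Attached-consecutive : ∀ ps u t qs → P ≡ ps ++ u ∷ t ∷ qs → Attached u → ¬ Attached t
    ¬Attached-consecutive ps u t qs P≡ (x , reach-x , ux) (y , reach-y , ty)
      with detour reach-x reach-y
    ... | q , (walk-q , !q) , end , off = no-longer-walk P≡ q !q off _ new↭ walk
      where
      split : IsWalk G (ps ++ [ u ]) × IsWalk G (u ∷ t ∷ qs)
      split = IsWalk-split G ps u (t ∷ qs) (proj₁ (pathL P≡))
      walk : IsWalk G (ps ++ u ∷ x ∷ q ++ t ∷ qs)
      walk = IsWalk-join G ps u (x ∷ q ++ t ∷ qs) (proj₁ split)
               (IsWalk-detour G u x q t qs ux walk-q end (trans (Graph.sym G y t) ty) (IsWalk-tail G (proj₂ split)))
      new↭ : ps ++ u ∷ x ∷ q ++ t ∷ qs ↭ (x ∷ q) ++ ps ++ u ∷ t ∷ qs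
      new↭ = ↭-trans (++⁺ˡ ps (↭-sym (shift u (x ∷ q) (t ∷ qs)))) (shifts ps (x ∷ q))

    -- Pósa rotation: if v₁ t is an edge, then x u … v₁ t … is a path for a neighbour x of u.
    ¬Attached-before-first-neighbour : ∀ v₁ rs t qs → P ≡ (v₁ ∷ rs) ++ t ∷ qs → adj G v₁ t ≡ true →
                                       ∀ {u} → EndsAt u (v₁ ∷ rs) → ¬ Attached u
    ¬Attached-before-first-neighbour v₁ rs t qs P≡ v₁t end (x , reach , ux) with EndsAt⇒∃ end
    ... | ps , v₁∷rs≡ = no-longer-walk₁ P≡ reach _ (prep x (++⁺ʳ (t ∷ qs) (↭-reverse (v₁ ∷ rs)))) walk
      where
      walk-to-x : IsWalk G ((v₁ ∷ rs) ++ [ x ])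
      walk-to-x = subst (λ z → IsWalk G (z ++ [ x ])) (sym v₁∷rs≡)
        (subst (IsWalk G) (sym (++-assoc ps [ _ ] [ x ]))
          (IsWalk-snoc G ps _ x (proj₁ (IsWalk-split G ps _ (t ∷ qs)
            (subst (IsWalk G) (trans (cong (_++ t ∷ qs) v₁∷rs≡) (++-assoc ps [ _ ] (t ∷ qs)))
              (proj₁ (pathL P≡)))))
          ux))
      walk-from-x : IsWalk G (x ∷ reverse rs ++ [ v₁ ])
      walk-from-x = subst (IsWalk G) (trans (reverse-++ (v₁ ∷ rs) [ x ]) (cong (x ∷_) (unfold-reverse v₁ rs)))
                      (IsWalk-reverse G _ walk-to-x)
      walk : IsWalk G (x ∷ reverse (v₁ ∷ rs) ++ t ∷ qs)
      walk = subst (λ z → IsWalk G (x ∷ z ++ t ∷ qs)) (sym (unfold-reverse v₁ rs))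
        (subst (λ z → IsWalk G (x ∷ z)) (sym (++-assoc (reverse rs) [ v₁ ] (t ∷ qs)))
          (IsWalk-join G (x ∷ reverse rs) v₁ (t ∷ qs) walk-from-x
            (v₁t , proj₂ (IsWalk-split G (v₁ ∷ rs) t qs (proj₁ (pathL P≡))))))

    -- Otherwise, for neighbours x of u and y of w in the component,
    -- … u x … y w … t t′ … would be a longer path.
    ¬adjacent-successors : ∀ ps u t rs w t′ qs → P ≡ ps ++ u ∷ t ∷ rs ++ w ∷ t′ ∷ qs →
                           Attached u → Attached w → ¬ adj G t t′ ≡ true
    ¬adjacent-successors ps u t rs w t′ qs P≡ (x , reach-x , ux) (y , reach-y , wy) tt′
      with detour reach-x reach-y
    ... | q , (walk-q , !q) , end , off = no-longer-walk P≡ q !q off _ new↭ walk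
      where
      split₁ : IsWalk G (ps ++ [ u ]) × IsWalk G (u ∷ t ∷ rs ++ w ∷ t′ ∷ qs)
      split₁ = IsWalk-split G ps u (t ∷ rs ++ w ∷ t′ ∷ qs) (proj₁ (pathL P≡))
      split₂ : IsWalk G ((t ∷ rs) ++ [ w ]) × IsWalk G (w ∷ t′ ∷ qs)
      split₂ = IsWalk-split G (t ∷ rs) w (t′ ∷ qs) (IsWalk-tail G (proj₂ split₁))
      walk-back : IsWalk G (w ∷ reverse rs ++ [ t ])
      walk-back = subst (IsWalk G) (trans (reverse-++ (t ∷ rs) [ w ]) (cong (w ∷_) (unfold-reverse t rs)))
                    (IsWalk-reverse G _ (proj₁ split₂))
      walk-tail : IsWalk G (w ∷ reverse (t ∷ rs) ++ t′ ∷ qs)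
      walk-tail = subst (λ z → IsWalk G (w ∷ z ++ t′ ∷ qs)) (sym (unfold-reverse t rs))
        (subst (λ z → IsWalk G (w ∷ z)) (sym (++-assoc (reverse rs) [ t ] (t′ ∷ qs)))
          (IsWalk-join G (w ∷ reverse rs) t (t′ ∷ qs) walk-back (tt′ , IsWalk-tail G (proj₂ split₂))))
      walk : IsWalk G (ps ++ u ∷ x ∷ q ++ w ∷ reverse (t ∷ rs) ++ t′ ∷ qs)
      walk = IsWalk-join G ps u _ (proj₁ split₁)
               (IsWalk-detour G u x q w _ ux walk-q end (trans (Graph.sym G y w) wy) walk-tail)
      new↭ : ps ++ u ∷ x ∷ q ++ w ∷ reverse (t ∷ rs) ++ t′ ∷ qs
               ↭ (x ∷ q) ++ ps ++ u ∷ t ∷ rs ++ w ∷ t′ ∷ qs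
      new↭ = ↭-trans (↭-trans (++⁺ˡ ps (↭-sym (shift u (x ∷ q) _))) (shifts ps (x ∷ q)))
               (++⁺ˡ (x ∷ q) (++⁺ˡ ps (prep u
                 (↭-trans (prep w (++⁺ʳ (t′ ∷ qs) (↭-reverse (t ∷ rs))))
                          (↭-sym (shift w (t ∷ rs) (t′ ∷ qs)))))))

    successors : Fin n → List (Fin n) → List (Fin n)
    successors a []       = []
    successors a (b ∷ ps) = (if attached a then b ∷_ else id) (successors b ps)

    ∈-successors⁻ : ∀ a ps {t} → t ∈ successors a ps →
                    ∃[ as ] ∃[ u ] ∃[ qs ] a ∷ ps ≡ as ++ u ∷ t ∷ qs × attached u ≡ true
    ∈-successors⁻ a (b ∷ ps) t∈ with attached a in attached-a
    ∈-successors⁻ a (b ∷ ps) (here refl) | true = [] , a , ps , refl , attached-a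
    ∈-successors⁻ a (b ∷ ps) (there t∈) | true with ∈-successors⁻ b ps t∈
    ... | as , u , qs , eq , attached-u = a ∷ as , u , qs , cong (a ∷_) eq , attached-u
    ∈-successors⁻ a (b ∷ ps) t∈ | false with ∈-successors⁻ b ps t∈
    ... | as , u , qs , eq , attached-u = a ∷ as , u , qs , cong (a ∷_) eq , attached-u

    successors⊆ : ∀ a ps {t} → t ∈ successors a ps → t ∈ ps
    successors⊆ a (b ∷ ps) t∈ with attached a
    successors⊆ a (b ∷ ps) (here refl) | true = here refl
    successors⊆ a (b ∷ ps) (there t∈)  | true = there (successors⊆ b ps t∈)
    successors⊆ a (b ∷ ps) t∈          | false = there (successors⊆ b ps t∈)

    successors-unique : ∀ a ps → Unique (a ∷ ps) → Unique (successors a ps)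
    successors-unique a []       _         = []
    successors-unique a (b ∷ ps) (_ ∷ !ps) with attached a
    ... | true  = ¬Any⇒All¬ _ (All¬⇒¬Any (AllPairs.head !ps) ∘ successors⊆ b ps)
                  ∷ successors-unique b ps !ps
    ... | false = successors-unique b ps !ps

    length-successors : ∀ a ps {vₗ} → EndsAt vₗ (a ∷ ps) → attached vₗ ≡ false →
                        length (successors a ps) ≡ count attached (a ∷ ps)
    length-successors a [] single ¬attached-a with attached a
    ... | false = refl
    length-successors a (b ∷ ps) (there end) ¬attached with attached a
    ... | true  = cong suc (length-successors b ps end ¬attached)
    ... | false = length-successors b ps end ¬attached

    successors-independent : ∀ ps a qs → P ≡ ps ++ a ∷ qs → IndependentList G (successors a qs)
    successors-independent ps a []       _  = []
    successors-independent ps a (b ∷ qs) P≡ with attached a in attached-a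
    ... | false = successors-independent (ps ++ [ a ]) b qs (trans P≡ (sym (++-assoc ps [ a ] (b ∷ qs))))
    ... | true  = All.tabulate (nonadjacent ∘ ∈-successors⁻ b qs)
                ∷ successors-independent (ps ++ [ a ]) b qs (trans P≡ (sym (++-assoc ps [ a ] (b ∷ qs))))
      where
      nonadjacent : ∀ {t′} → ∃[ as ] ∃[ w ] ∃[ rs ] b ∷ qs ≡ as ++ w ∷ t′ ∷ rs × attached w ≡ true →
                    adj G b t′ ≡ false
      nonadjacent ([] , _ , rs , refl , attached-w) =
        ⊥-elim (¬Attached-consecutive ps a b _ P≡ (attached⁻ attached-a) (attached⁻ attached-w))
      nonadjacent {t′} (_ ∷ as , w , rs , refl , attached-w) =
        ¬-not (¬adjacent-successors ps a b as w t′ rs P≡ (attached⁻ attached-a) (attached⁻ attached-w))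

    first-entry : ∀ {v} c cs → c ∉ P → EndsAt v (c ∷ cs) → v ∈ P →
                  ∃[ as ] ∃[ a ] ∃[ b ] ∃[ bs ] c ∷ cs ≡ as ++ a ∷ b ∷ bs × OffPath (as ++ [ a ]) × b ∈ P
    first-entry c []       c∉P single      v∈P = ⊥-elim (c∉P v∈P)
    first-entry c (b ∷ cs) c∉P (there end) v∈P with b ∈? P
    ... | yes b∈P = [] , c , b , cs , refl , c∉P ∷ [] , b∈P
    ... | no b∉P with first-entry b cs b∉P end v∈P
    ... | as , a , b′ , bs , eq , off , b′∈P = c ∷ as , a , b′ , bs , cong (c ∷_) eq , c∉P ∷ off , b′∈P

    reachable-prefix : ∀ {w} as {a rest} → h ∷ w ≡ as ++ a ∷ rest →
                       IsWalk G (as ++ [ a ]) → OffPath (as ++ [ a ]) → Reachable a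
    reachable-prefix []       refl _    _   = reachable-h
    reachable-prefix (_ ∷ as) refl walk off = as ++ [ _ ] , walk , EndsAt-++ _ (_ ∷ as) , off

    module _ {v₁ ps} (P≡ : P ≡ v₁ ∷ ps) where

      ¬attached-first : attached v₁ ≡ false
      ¬attached-first = ¬-not (¬Attached-first P≡ ∘ attached⁻)

      ¬attached-last : ∀ {vₗ} → EndsAt vₗ P → attached vₗ ≡ false
      ¬attached-last end with EndsAt⇒∃ end
      ... | qs , P≡qs++vₗ = ¬-not (¬Attached-last P≡qs++vₗ ∘ attached⁻)

      -- The attached vertices separate h from v₁.
      k≤count-attached : ∀ {k} → KConnected k G → k ≤ count attached P
      k≤count-attached {k} (_ , connected) with k ≤? count attached P
      ... | yes k≤ = k≤
      ... | no k≰ with connected S (filterᵗ-unique attached (proj₂ path)) |S|<k h v₁ h∉S v₁∉S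
        where
        S : List (Fin n)
        S = filterᵗ attached P
        |S|<k : length S < k
        |S|<k = subst (_< k) (sym (length-filterᵗ attached P)) (≰⇒> k≰)
        h∉S : h ∉ S
        h∉S h∈S = h∉P (proj₁ (∈-filterᵗ⁻ attached {P} h∈S))
        v₁∉S : v₁ ∉ S
        v₁∉S v₁∈S with trans (sym (proj₂ (∈-filterᵗ⁻ attached {P} v₁∈S))) ¬attached-first
        ... | ()
      ... | h ∷ w , walk , here , end , avoids
        with first-entry h w h∉P end (subst (v₁ ∈_) (sym P≡) (here refl))
      ... | as , a , b , bs , w≡ , off , b∈P = ⊥-elim (All.lookup avoids b∈w b∈S)
        where
        split : IsWalk G (as ++ [ a ]) × IsWalk G (a ∷ b ∷ bs)
        split = IsWalk-split G as a (b ∷ bs) (subst (IsWalk G) w≡ walk)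
        reach-a : Reachable a
        reach-a = reachable-prefix as w≡ (proj₁ split) off
        b∈w : b ∈ h ∷ w
        b∈w = subst (b ∈_) (sym w≡) (∈-++⁺ʳ as (there (here refl)))
        b∈S : b ∈ filterᵗ attached P
        b∈S = ∈-filterᵗ⁺ attached b∈P (attached⁺ (a , reach-a , trans (Graph.sym G b a) (proj₁ (proj₂ split))))

      private
        h-v₁ : adj G h v₁ ≡ false
        h-v₁ = ¬-not λ hv₁ → ¬Attached-first P≡ (h , reachable-h , trans (Graph.sym G v₁ h) hv₁)

        h-successor : ∀ {t} → t ∈ successors v₁ ps → adj G h t ≡ false
        h-successor {t} t∈ with ∈-successors⁻ v₁ ps t∈
        ... | as , u , qs , eq , attached-u = ¬-not λ ht →
          ¬Attached-consecutive as u t qs (trans P≡ eq) (attached⁻ attached-u)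
            (h , reachable-h , trans (Graph.sym G t h) ht)

        v₁-successor : ∀ {t} → t ∈ successors v₁ ps → adj G v₁ t ≡ false
        v₁-successor {t} t∈ with ∈-successors⁻ v₁ ps t∈
        ... | [] , u , qs , refl , attached-u = ¬-not λ v₁t →
          ¬Attached-before-first-neighbour v₁ [] t qs P≡ v₁t single (attached⁻ attached-u)
        ... | _ ∷ as , u , qs , refl , attached-u = ¬-not λ v₁t →
          ¬Attached-before-first-neighbour v₁ (as ++ [ u ]) t qs
            (trans P≡ (cong (v₁ ∷_) (sym (++-assoc as [ u ] (t ∷ qs))))) v₁t
            (EndsAt-++ u (v₁ ∷ as)) (attached⁻ attached-u)

      independent-around-path : IndependentList G (h ∷ v₁ ∷ successors v₁ ps)
      independent-around-path =
        (h-v₁ ∷ All.tabulate h-successor) ∷ All.tabulate v₁-successor ∷ successors-independent [] v₁ ps P≡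

      unique-around-path : Unique (h ∷ v₁ ∷ successors v₁ ps)
      unique-around-path =
        ¬Any⇒All¬ _ h∉ ∷ ¬Any⇒All¬ _ (All¬⇒¬Any (AllPairs.head !P) ∘ successors⊆ v₁ ps)
        ∷ successors-unique v₁ ps !P
        where
        !P : Unique (v₁ ∷ ps)
        !P = subst Unique P≡ (proj₂ path)
        h∉ : h ∉ v₁ ∷ successors v₁ ps
        h∉ (here refl) = h∉P (subst (h ∈_) (sym P≡) (here refl))
        h∉ (there h∈)  = h∉P (subst (h ∈_) (sym P≡) (there (successors⊆ v₁ ps h∈)))

      k+2≤length-around-path : ∀ {k} → KConnected k G → k + 2 ≤ length (h ∷ v₁ ∷ successors v₁ ps)
      k+2≤length-around-path {k} connected = begin
        k + 2                          ≤⟨ +-monoˡ-≤ 2 (k≤count-attached connected) ⟩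
        count attached P + 2           ≡⟨ cong (λ z → count attached z + 2) P≡ ⟩
        count attached (v₁ ∷ ps) + 2   ≡⟨ cong (_+ 2) (length-successors v₁ ps end ¬attached-vₗ) ⟨
        length (successors v₁ ps) + 2  ≡⟨ +-comm _ 2 ⟩
        2 + length (successors v₁ ps)  ∎
        where
        open ≤-Reasoning
        last : ∀ a as → ∃ λ vₗ → EndsAt vₗ (a ∷ as)
        last a []       = a , single
        last a (b ∷ as) = proj₁ (last b as) , there (proj₂ (last b as))
        vₗ : Fin n
        vₗ = proj₁ (last v₁ ps)
        end : EndsAt vₗ (v₁ ∷ ps)
        end = proj₂ (last v₁ ps)
        ¬attached-vₗ : attached vₗ ≡ false
        ¬attached-vₗ = ¬attached-last (subst (EndsAt vₗ) (sym P≡) end)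

  <ᵇ-true : ∀ {a b} → a < b → (a <ᵇ b) ≡ true
  <ᵇ-true a<b = Equivalence.to T-≡ (<⇒<ᵇ a<b)

  <ᵇ-false : ∀ {a b} → ¬ a < b → (a <ᵇ b) ≡ false
  <ᵇ-false {a} {b} a≮b = ¬-not λ a<ᵇb → a≮b (<ᵇ⇒< a b (Equivalence.from T-≡ a<ᵇb))

  module _ {n : ℕ} (G : Graph n) where

    adjℕ : Fin n → Fin n → ℕ
    adjℕ u v = 𝟙 (adj G u v)

    deg≡∑adjℕ : ∀ u → deg G u ≡ ∑ (adjℕ u) (allFin n)
    deg≡∑adjℕ u = count≡∑𝟙 (adj G u) (allFin n)

    M₁≡∑deg² : M₁ G ≡ ∑ (λ u → deg G u * deg G u) (allFin n)
    M₁≡∑deg² = foldr-map≡∑ _ (allFin n)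

    -- Each adjacency u v is split into the ordered pair with the smaller end first.
    handshake : ∑ (deg G) (allFin n) ≡ edges G + edges G
    handshake = begin
      ∑ (deg G) V
        ≡⟨ ∑-cong V (λ {u} _ → deg≡∑adjℕ u) ⟩
      ∑ (λ u → ∑ (adjℕ u) V) V
        ≡⟨ ∑-cong V (λ {u} _ → ∑-cong V (λ {v} _ → adjℕ≡ u v)) ⟩
      ∑ (λ u → ∑ (λ v → E u v + E v u) V) V
        ≡⟨ ∑-cong V (λ {u} _ → ∑-+ (E u) (λ v → E v u) V) ⟩
      ∑ (λ u → ∑ (E u) V + ∑ (λ v → E v u) V) V
        ≡⟨ ∑-+ _ _ V ⟩
      ∑ (λ u → ∑ (E u) V) V + ∑ (λ u → ∑ (λ v → E v u) V) V
        ≡⟨ cong (∑ (λ u → ∑ (E u) V) V +_) (∑-comm (λ u v → E v u) V V) ⟩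
      ∑ (λ u → ∑ (E u) V) V + ∑ (λ u → ∑ (E u) V) V
        ≡⟨ cong₂ _+_ edges≡ edges≡ ⟨
      edges G + edges G ∎
      where
      open ≡-Reasoning
      V : List (Fin n)
      V = allFin n
      E : Fin n → Fin n → ℕ
      E u v = 𝟙 ((toℕ u <ᵇ toℕ v) ∧ adj G u v)
      adjℕ≡ : ∀ u v → adjℕ u v ≡ E u v + E v u
      adjℕ≡ u v with <-cmp (toℕ u) (toℕ v)
      ... | tri< u<v _ v≮u rewrite <ᵇ-true u<v | <ᵇ-false v≮u = sym (+-identityʳ _)
      ... | tri> u≮v _ v<u rewrite <ᵇ-true v<u | <ᵇ-false u≮v | Graph.sym G v u = refl
      ... | tri≈ u≮v u≡v _ rewrite toℕ-injective u≡v | irrefl G v | <ᵇ-false u≮v = refl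
      edges≡ : edges G ≡ ∑ (λ u → ∑ (E u) V) V
      edges≡ = trans (foldr-map≡∑ _ V) (∑-cong V (λ _ → count≡∑𝟙 _ V))

    deg≤maxDeg : ∀ u → deg G u ≤ maxDeg G
    deg≤maxDeg u = ≤-foldr-⊔ (map (deg G) (allFin n)) (∈-map⁺ (deg G) (∈-allFin u))
      where
      ≤-foldr-⊔ : ∀ xs {x} → x ∈ xs → x ≤ foldr _⊔_ 0 xs
      ≤-foldr-⊔ (y ∷ ys) (here refl) = m≤m⊔n y _
      ≤-foldr-⊔ (y ∷ ys) (there x∈)  = ≤-trans (≤-foldr-⊔ ys x∈) (m≤n⊔m y _)

    minDeg≤deg : ∀ u → minDeg G ≤ deg G u
    minDeg≤deg u = foldr-⊓-≤ (map (deg G) (allFin n)) (∈-map⁺ (deg G) (∈-allFin u))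
      where
      foldr-⊓-≤ : ∀ xs {x} → x ∈ xs → foldr _⊓_ n xs ≤ x
      foldr-⊓-≤ (y ∷ ys) (here refl) = m⊓n≤m y _
      foldr-⊓-≤ (y ∷ ys) (there x∈)  = ≤-trans (m⊓n≤n y _) (foldr-⊓-≤ ys x∈)

    ≤minDeg : ∀ {k} → k ≤ n → (∀ u → k ≤ deg G u) → k ≤ minDeg G
    ≤minDeg {k} k≤n k≤deg = ≤-foldr-⊓ (map (deg G) (allFin n)) (λ x∈ → k≤deg′ (∈-map⁻ (deg G) x∈))
      where
      k≤deg′ : ∀ {x} → ∃ (λ u → u ∈ allFin n × x ≡ deg G u) → k ≤ x
      k≤deg′ (u , _ , refl) = k≤deg u
      ≤-foldr-⊓ : ∀ xs → (∀ {x} → x ∈ xs → k ≤ x) → k ≤ foldr _⊓_ n xs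
      ≤-foldr-⊓ []       _     = k≤n
      ≤-foldr-⊓ (y ∷ ys) k≤ys = ⊓-glb (k≤ys (here refl)) (≤-foldr-⊓ ys (k≤ys ∘ there))

    ¬neighbours⊆ : ∀ {S u v} → ConnectedAvoiding G S → u ∉ S → v ∉ S → u ≢ v →
                   ¬ (∀ b → adj G u b ≡ true → b ∈ S)
    ¬neighbours⊆ {S} {u} {v} connected u∉S v∉S u≢v N⊆S with connected u v u∉S v∉S
    ... | u ∷ []    , _        , here , single   , _            = u≢v refl
    ... | u ∷ []    , _        , here , there () , _
    ... | u ∷ b ∷ _ , (ub , _) , here , _        , _ ∷ b∉S ∷ _ = b∉S (N⊆S b ub)

    k≤deg : ∀ {k} → KConnected k G → ∀ u → k ≤ deg G u
    k≤deg {k} (k<n , connected) u with k ≤? deg G u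
    ... | yes k≤ = k≤
    ... | no k≰ with any? (λ v → (adj G u v ≟ᵇ false) ×-dec ¬? (v ≟ᶠ u))
    ... | yes (v , uv , v≢u) = ⊥-elim (¬neighbours⊆ (connected N (filterᵗ-unique _ (allFin⁺ n)) |N|<k)
                                 u∉N v∉N (v≢u ∘ sym) (λ b ub → ∈-filterᵗ⁺ (adj G u) (∈-allFin b) ub))
      where
      N : List (Fin n)
      N = filterᵗ (adj G u) (allFin n)
      |N|<k : length N < k
      |N|<k = subst (_< k) (sym (length-filterᵗ (adj G u) (allFin n))) (≰⇒> k≰)
      ∉N : ∀ {w} → adj G u w ≡ false → w ∉ N
      ∉N uw w∈N with trans (sym (proj₂ (∈-filterᵗ⁻ (adj G u) {allFin n} w∈N))) uw
      ... | ()
      u∉N : u ∉ N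
      u∉N = ∉N (irrefl G u)
      v∉N : v ∉ N
      v∉N = ∉N uv
    ... | no ¬nonneighbour = ⊥-elim (k≰ (≤-pred (≤-trans k<n n≤deg+1)))
      where
      only-u : ∀ {v} → v ∈ filterᵗ (not ∘ adj G u) (allFin n) → v ∈ [ u ]
      only-u {v} v∈ with v ≟ᶠ u | adj G u v in uv | proj₂ (∈-filterᵗ⁻ (not ∘ adj G u) {allFin n} v∈)
      ... | yes refl | _     | _  = here refl
      ... | no v≢u   | false | _  = ⊥-elim (¬nonneighbour (v , uv , v≢u))
      ... | no v≢u   | true  | ()
      n≤deg+1 : n ≤ suc (deg G u)
      n≤deg+1 = begin
        n
          ≡⟨ length-allFin n ⟨
        length (allFin n)
          ≡⟨ count+count-not (adj G u) (allFin n) ⟨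
        deg G u + count (not ∘ adj G u) (allFin n)
          ≡⟨ cong (deg G u +_) (length-filterᵗ _ (allFin n)) ⟨
        deg G u + length (filterᵗ (not ∘ adj G u) (allFin n))
          ≤⟨ +-monoʳ-≤ (deg G u) (unique⊆⇒length≤ (filterᵗ-unique _ (allFin⁺ n)) only-u) ⟩
        deg G u + 1
          ≡⟨ +-comm (deg G u) 1 ⟩
        suc (deg G u) ∎
        where open ≤-Reasoning

    k≤minDeg : ∀ {k} → KConnected k G → k ≤ minDeg G
    k≤minDeg connected = ≤minDeg (<⇒≤ (proj₁ connected)) (k≤deg connected)

    IsIndependent : (Fin n → Bool) → Set
    IsIndependent s = ∀ {u v} → s u ≡ true → s v ≡ true → adj G u v ≡ false

    -- The complement of an independent set with two vertices separates them.
    k≤count-complement : ∀ {k} → KConnected k G → ∀ {s} → IsIndependent s →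
                         ∀ {u v} → s u ≡ true → s v ≡ true → u ≢ v → k ≤ count (not ∘ s) (allFin n)
    k≤count-complement {k} (_ , connected) {s} independent {u} {v} su sv u≢v
      with k ≤? count (not ∘ s) (allFin n)
    ... | yes k≤ = k≤
    ... | no k≰ =
      ⊥-elim (¬neighbours⊆ (connected J (filterᵗ-unique _ (allFin⁺ n)) |J|<k) (∉J su) (∉J sv) u≢v N⊆J)
      where
      J : List (Fin n)
      J = filterᵗ (not ∘ s) (allFin n)
      |J|<k : length J < k
      |J|<k = subst (_< k) (sym (length-filterᵗ _ (allFin n))) (≰⇒> k≰)
      ∉J : ∀ {w} → s w ≡ true → w ∉ J
      ∉J sw w∈J with trans (sym (proj₂ (∈-filterᵗ⁻ (not ∘ s) {allFin n} w∈J))) (cong not sw)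
      ... | ()
      N⊆J : ∀ b → adj G u b ≡ true → b ∈ J
      N⊆J b ub with s b in sb
      ... | false = ∈-filterᵗ⁺ (not ∘ s) (∈-allFin b) (cong not sb)
      ... | true with trans (sym ub) (independent su sb)
      ... | ()

  record IndependentSet {n} (G : Graph n) (m : ℕ) : Set where
    field
      member      : Fin n → Bool
      independent : IsIndependent G member
      size        : count member (allFin n) ≡ m

    two-members : 2 ≤ m → ∃[ u ] ∃[ v ] member u ≡ true × member v ≡ true × u ≢ v
    two-members 2≤m with two-distinct (filterᵗ-unique member (allFin⁺ n))
                           (subst (2 ≤_) (sym (trans (length-filterᵗ member (allFin n)) size)) 2≤m)
      where
      two-distinct : ∀ {xs : List (Fin n)} → Unique xs → 2 ≤ length xs → ∃[ u ] ∃[ v ] u ∈ xs × v ∈ xs × u ≢ v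
      two-distinct {_ ∷ []}    _        (s≤s ())
      two-distinct {u ∷ v ∷ _} (u∉ ∷ _) _ = u , v , here refl , there (here refl) , All.head u∉
    ... | u , v , u∈ , v∈ , u≢v =
      u , v , proj₂ (∈-filterᵗ⁻ member {allFin n} u∈) , proj₂ (∈-filterᵗ⁻ member {allFin n} v∈) , u≢v

  module _ {n : ℕ} (G : Graph n) where

    open DecMembership (_≟ᶠ_ {n}) using (_∈?_)

    count-∈? : ∀ {xs} → Unique xs → count (λ x → does (x ∈? xs)) (allFin n) ≡ length xs
    count-∈? {xs} !xs = begin
      count ∈xs (allFin n)
        ≡⟨ length-filterᵗ ∈xs (allFin n) ⟨
      length (filterᵗ ∈xs (allFin n))
        ≡⟨ ≤-antisym (unique⊆⇒length≤ (filterᵗ-unique ∈xs (allFin⁺ n)) ⊆xs)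
                                                    (unique⊆⇒length≤ !xs xs⊆) ⟩
      length xs                       ∎
      where
      open ≡-Reasoning
      ∈xs : Fin n → Bool
      ∈xs x = does (x ∈? xs)
      ⊆xs : ∀ {z} → z ∈ filterᵗ ∈xs (allFin n) → z ∈ xs
      ⊆xs {z} z∈ = does≡true⇒ (z ∈? xs) (proj₂ (∈-filterᵗ⁻ ∈xs {allFin n} z∈))
      xs⊆ : ∀ {z} → z ∈ xs → z ∈ filterᵗ ∈xs (allFin n)
      xs⊆ {z} z∈ = ∈-filterᵗ⁺ ∈xs (∈-allFin z) (dec-true (z ∈? xs) z∈)

    independent-list⇒set : ∀ {m xs} → Unique xs → IndependentList G xs → m ≤ length xs → IndependentSet G m
    independent-list⇒set {m} {xs} !xs independent m≤ = record
      { member      = λ x → does (x ∈? ys)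
      ; independent = λ {u} {v} u∈ v∈ → independent-∈ (AllPairsₚ.take⁺ m independent)
                                           (does≡true⇒ (u ∈? ys) u∈) (does≡true⇒ (v ∈? ys) v∈)
      ; size        = trans (count-∈? (take⁺ m !xs)) (trans (length-take m xs) (m≤n⇒m⊓n≡m m≤))
      }
      where
      ys : List (Fin n)
      ys = take m xs
      independent-∈ : ∀ {zs} → IndependentList G zs → ∀ {u v} → u ∈ zs → v ∈ zs → adj G u v ≡ false
      independent-∈ (_ ∷ _)         (here refl) (here refl) = irrefl G _
      independent-∈ (u-zs ∷ _)      (here refl) (there v∈)  = All.lookup u-zs v∈
      independent-∈ (v-zs ∷ _)      (there u∈)  (here refl) = trans (Graph.sym G _ _) (All.lookup v-zs u∈)
      independent-∈ (_ ∷ indep-zs) (there u∈)  (there v∈)  = independent-∈ indep-zs u∈ v∈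

    traceable-or-independent : ∀ {k} → KConnected k G → Traceable G ⊎ IndependentSet G (k + 2)
    traceable-or-independent {k} connected with longestPath G
    ... | P , path , longest with length P ≟ n
    ... | yes len = inj₁ (P , proj₁ path , proj₂ path , len)
    ... | no len≢n with any? (λ x → ¬? (x ∈? P))
    ... | no ¬outside = ⊥-elim (len≢n (≤-antisym (unique⇒length≤n (proj₂ path)) n≤len))
      where
      n≤len : n ≤ length P
      n≤len = subst (_≤ length P) (length-allFin n)
                (unique⊆⇒length≤ (allFin⁺ n) λ {z} _ →
                  decidable-stable (z ∈? P) (λ z∉P → ¬outside (z , z∉P)))
    ... | yes (h , h∉P) = around P path longest h∉P
      where
      around : ∀ P → IsPath G P → IsLongest G P → ∀ {h} → h ∉ P → Traceable G ⊎ IndependentSet G (k + 2)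
      around []        _    longest {h} _ with longest [ h ] (tt , [] ∷ [])
      ... | ()
      around (v₁ ∷ ps) path longest h∉P = inj₂ (independent-list⇒set
        (unique-around-path refl) (independent-around-path refl) (k+2≤length-around-path refl connected))
        where open LongestPath G path longest h∉P

  -- For δ ≤ x ≤ D the product (x − δ)(D − x) is nonnegative.
  sq+δD≤[δ+D]* : ∀ {δ x D} → δ ≤ x → x ≤ D → x * x + δ * D ≤ (δ + D) * x
  sq+δD≤[δ+D]* {δ} δ≤x x≤D with m≤n⇒∃[o]m+o≡n δ≤x
  ... | p , refl with m≤n⇒∃[o]m+o≡n x≤D
  ... | q , refl = ≤-trans (m≤m+n _ (q * p)) (≤-reflexive (sym (expand δ p q)))
    where
    expand : ∀ δ p q → (δ + (δ + p + q)) * (δ + p) ≡ (δ + p) * (δ + p) + δ * (δ + p + q) + q * p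
    expand = solve-∀

  sq+δD≡[δ+D]*⇒ : ∀ {δ x D} → δ ≤ x → x ≤ D → x * x + δ * D ≡ (δ + D) * x → x ≡ δ ⊎ x ≡ D
  sq+δD≡[δ+D]*⇒ {δ} δ≤x x≤D eq with m≤n⇒∃[o]m+o≡n δ≤x
  ... | p , refl with m≤n⇒∃[o]m+o≡n x≤D
  ... | q , refl
    with m*n≡0⇒m≡0∨n≡0 q (sym (+-cancelˡ-≡ _ _ _ (trans (+-identityʳ _) (trans eq (expand δ p q)))))
    where
    expand : ∀ δ p q → (δ + (δ + p + q)) * (δ + p) ≡ (δ + p) * (δ + p) + δ * (δ + p + q) + q * p
    expand = solve-∀
  ... | inj₁ refl = inj₂ (sym (+-identityʳ _))
  ... | inj₂ refl = inj₁ (+-identityʳ _)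

  private
    square-expand : ∀ a t → a * a + (a + t) * (a + t) ≡ 2 * a * (a + t) + t * t
    square-expand = solve-∀

    2ab-comm : ∀ a b → 2 * a * b ≡ 2 * b * a
    2ab-comm = solve-∀

    square≡0 : ∀ t → t * t ≡ 0 → t ≡ 0
    square≡0 zero _ = refl

    2ab≤a²+b²-≤ : ∀ {a b} → a ≤ b → 2 * a * b ≤ a * a + b * b
    2ab≤a²+b²-≤ {a} a≤b with m≤n⇒∃[o]m+o≡n a≤b
    ... | t , refl = ≤-trans (m≤m+n _ (t * t)) (≤-reflexive (sym (square-expand a t)))

    2ab≡a²+b²⇒≡-≤ : ∀ {a b} → a ≤ b → 2 * a * b ≡ a * a + b * b → a ≡ b
    2ab≡a²+b²⇒≡-≤ {a} a≤b eq with m≤n⇒∃[o]m+o≡n a≤b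
    ... | t , refl
      rewrite square≡0 t (sym (+-cancelˡ-≡ _ _ _ (trans (+-identityʳ _) (trans eq (square-expand a t)))))
      = sym (+-identityʳ a)

  2ab≤a²+b² : ∀ a b → 2 * a * b ≤ a * a + b * b
  2ab≤a²+b² a b with ≤-total a b
  ... | inj₁ a≤b = 2ab≤a²+b²-≤ a≤b
  ... | inj₂ b≤a = subst₂ _≤_ (2ab-comm b a) (+-comm (b * b) (a * a)) (2ab≤a²+b²-≤ b≤a)

  2ab≡a²+b²⇒≡ : ∀ a b → 2 * a * b ≡ a * a + b * b → a ≡ b
  2ab≡a²+b²⇒≡ a b eq with ≤-total a b
  ... | inj₁ a≤b = 2ab≡a²+b²⇒≡-≤ a≤b eq
  ... | inj₂ b≤a = sym (2ab≡a²+b²⇒≡-≤ b≤a (trans (2ab-comm b a) (trans eq (+-comm (a * a) (b * b)))))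

  *-square-injective : ∀ {a b} → a * a ≡ b * b → a ≡ b
  *-square-injective {a} {b} eq with <-cmp a b
  ... | tri< a<b _ _ = ⊥-elim (<-irrefl eq (*-mono-< a<b a<b))
  ... | tri≈ _ a≡b _ = a≡b
  ... | tri> _ _ b<a = ⊥-elim (<-irrefl (sym eq) (*-mono-< b<a b<a))

  +-mono-≤-tight : ∀ {a a′ b b′} → a ≤ a′ → b ≤ b′ → a′ + b′ ≤ a + b → a ≡ a′ × b ≡ b′
  +-mono-≤-tight {a} {a′} {b} {b′} a≤a′ b≤b′ tight =
    ≤-antisym a≤a′ (+-cancelʳ-≤ b a′ a (≤-trans (+-monoʳ-≤ a′ b≤b′) tight)) ,
    ≤-antisym b≤b′ (+-cancelˡ-≤ a b′ b (≤-trans (+-monoˡ-≤ b′ a≤a′) tight))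

  -- With c = 4δDm, X = (δ + D)S and Y = mδD, the bound M₁ ≤ DΔ² + (e(δ + D))²/c rests on
  -- MJ ≤ DΔ², MI + Y ≤ X, Xc ≤ X² + Yc (AM–GM) and S ≤ e; a matching lower bound makes all four tight.
  module TightEstimates {MI MJ D Δ m δ S e : ℕ} {{_ : NonZero δ}} {{_ : NonZero D}} {{_ : NonZero m}}
    (MJ≤ : MJ ≤ D * (Δ * Δ)) (MI≤ : MI + m * (δ * D) ≤ (δ + D) * S) (S≤e : S ≤ e)
    (bound : D * (Δ * Δ) * (4 * δ * D * m) + (e * (δ + D)) * (e * (δ + D)) ≤ (MI + MJ) * (4 * δ * D * m))
    where

    private
      c X Y E : ℕ
      c = 4 * δ * D * m
      X = (δ + D) * S
      Y = m * (δ * D)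
      E = e * (δ + D)

      instance
        c≢0 : NonZero c
        c≢0 = m*n≢0 (4 * δ * D) m {{m*n≢0 (4 * δ) D {{m*n≢0 4 δ}}}}

      Xc≡2X2Y : X * c ≡ 2 * X * (2 * Y)
      Xc≡2X2Y = rearrange X δ D m
        where
        rearrange : ∀ X δ D m → X * (4 * δ * D * m) ≡ 2 * X * (2 * (m * (δ * D)))
        rearrange = solve-∀

      Yc≡2Y2Y : Y * c ≡ 2 * Y * (2 * Y)
      Yc≡2Y2Y = rearrange δ D m
        where
        rearrange : ∀ δ D m → m * (δ * D) * (4 * δ * D * m) ≡ (2 * (m * (δ * D))) * (2 * (m * (δ * D)))
        rearrange = solve-∀

      Xc≤X²+Yc : X * c ≤ X * X + Y * c
      Xc≤X²+Yc = subst₂ _≤_ (sym Xc≡2X2Y) (cong (X * X +_) (sym Yc≡2Y2Y)) (2ab≤a²+b² X (2 * Y))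

      X≤E : X ≤ E
      X≤E = subst (X ≤_) (*-comm (δ + D) e) (*-monoʳ-≤ (δ + D) S≤e)

      L₁ L₂ L₃ L₄ : ℕ
      L₁ = MJ * c + (MI + Y) * c
      L₂ = D * (Δ * Δ) * c + X * c
      L₃ = D * (Δ * Δ) * c + (X * X + Y * c)
      L₄ = D * (Δ * Δ) * c + (E * E + Y * c)

      L₁≤L₂ : L₁ ≤ L₂
      L₁≤L₂ = +-mono-≤ (*-monoˡ-≤ c MJ≤) (*-monoˡ-≤ c MI≤)

      L₂≤L₃ : L₂ ≤ L₃
      L₂≤L₃ = +-monoʳ-≤ (D * (Δ * Δ) * c) Xc≤X²+Yc

      L₃≤L₄ : L₃ ≤ L₄
      L₃≤L₄ = +-monoʳ-≤ (D * (Δ * Δ) * c) (+-monoˡ-≤ (Y * c) (*-mono-≤ X≤E X≤E))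

      L₄≤L₁ : L₄ ≤ L₁
      L₄≤L₁ = begin
        D * (Δ * Δ) * c + (E * E + Y * c) ≡⟨ +-assoc (D * (Δ * Δ) * c) (E * E) (Y * c) ⟨
        D * (Δ * Δ) * c + E * E + Y * c   ≤⟨ +-monoˡ-≤ (Y * c) bound ⟩
        (MI + MJ) * c + Y * c             ≡⟨ regroup MI MJ Y c ⟩
        MJ * c + (MI + Y) * c             ∎
        where
        open ≤-Reasoning
        regroup : ∀ MI MJ Y c → (MI + MJ) * c + Y * c ≡ MJ * c + (MI + Y) * c
        regroup = solve-∀

      L₂≤L₁ : L₂ ≤ L₁
      L₂≤L₁ = ≤-trans L₂≤L₃ (≤-trans L₃≤L₄ L₄≤L₁)

      first-tight : MJ * c ≡ D * (Δ * Δ) * c × (MI + Y) * c ≡ X * c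
      first-tight = +-mono-≤-tight (*-monoˡ-≤ c MJ≤) (*-monoˡ-≤ c MI≤) L₂≤L₁

    MJ≡DΔ² : MJ ≡ D * (Δ * Δ)
    MJ≡DΔ² = *-cancelʳ-≡ MJ _ c (proj₁ first-tight)

    MI+mδD≡[δ+D]S : MI + m * (δ * D) ≡ (δ + D) * S
    MI+mδD≡[δ+D]S = *-cancelʳ-≡ _ _ c (proj₂ first-tight)

    [δ+D]S≡2mδD : (δ + D) * S ≡ 2 * (m * (δ * D))
    [δ+D]S≡2mδD = 2ab≡a²+b²⇒≡ X (2 * Y) (begin
      2 * X * (2 * Y)
        ≡⟨ Xc≡2X2Y ⟨
      X * c
        ≡⟨ +-cancelˡ-≡ (D * (Δ * Δ) * c) (X * c) (X * X + Y * c)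
             (≤-antisym L₂≤L₃ (≤-trans L₃≤L₄ (≤-trans L₄≤L₁ L₁≤L₂))) ⟩
      X * X + Y * c
        ≡⟨ cong (X * X +_) Yc≡2Y2Y ⟩
      X * X + 2 * Y * (2 * Y) ∎)
      where open ≡-Reasoning

    S≡e : S ≡ e
    S≡e = *-cancelˡ-≡ S e (δ + D) {{δ+D≢0}}
            (trans (*-square-injective (+-cancelʳ-≡ (Y * c) (X * X) (E * E)
                     (+-cancelˡ-≡ (D * (Δ * Δ) * c) _ _ (≤-antisym L₃≤L₄ (≤-trans L₄≤L₁ (≤-trans L₁≤L₂ L₂≤L₃))))))
                   (*-comm e (δ + D)))
      where
      δ+D≢0 : NonZero (δ + D)
      δ+D≢0 = >-nonZero (<-≤-trans (>-nonZero⁻¹ δ) (m≤m+n δ D))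

  private
    ≢+suc : ∀ a b → a ≢ a + suc b
    ≢+suc a b eq = m≢1+n+m a (trans eq (+-comm a (suc b)))

    -- δ = k + a, D = δ + 1 + b and Δ = D + c, where Δ ≤ k + 2 bounds a + b + c.
    unbalanced-offsets : ∀ k a b c → a + b + c ≤ 1 →
      (k + a + (suc (k + a) + b)) * (suc (k + a) + b + c) ≡ 2 * (k + 2) * (k + a) → k ≡ 1
    unbalanced-offsets k 1 0 0 _ eq = ⊥-elim (≢+suc _ _ (trans (sym eq) (expand k)))
      where
      expand : ∀ k → (k + 1 + (suc (k + 1) + 0)) * (suc (k + 1) + 0 + 0) ≡ 2 * (k + 2) * (k + 1) + suc (k + 1)
      expand = solve-∀
    unbalanced-offsets k 0 1 0 _ eq = ⊥-elim (≢+suc _ _ (trans (sym eq) (expand k)))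
      where
      expand : ∀ k → (k + 0 + (suc (k + 0) + 1)) * (suc (k + 0) + 1 + 0)
                     ≡ 2 * (k + 2) * (k + 0) + suc (2 * k + 3)
      expand = solve-∀
    unbalanced-offsets k 0 0 1 _ eq = ⊥-elim (≢+suc _ _ (trans (sym eq) (expand k)))
      where
      expand : ∀ k → (k + 0 + (suc (k + 0) + 0)) * (suc (k + 0) + 0 + 1) ≡ 2 * (k + 2) * (k + 0) + suc (k + 1)
      expand = solve-∀
    unbalanced-offsets k 0 0 0 _ eq =
      +-cancelˡ-≡ (2 * (k + 2) * (k + 0)) k 1 (trans (cong (_+ k) (sym eq)) (expand k))
      where
      expand : ∀ k → (k + 0 + (suc (k + 0) + 0)) * (suc (k + 0) + 0 + 0) + k ≡ 2 * (k + 2) * (k + 0) + 1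
      expand = solve-∀
    unbalanced-offsets k (suc (suc a)) b       c             (s≤s ())
    unbalanced-offsets k 1             (suc b) c             (s≤s ())
    unbalanced-offsets k 1             0       (suc c)       (s≤s ())
    unbalanced-offsets k 0             (suc (suc b)) c       (s≤s ())
    unbalanced-offsets k 0             1       (suc c)       (s≤s ())
    unbalanced-offsets k 0             0       (suc (suc c)) (s≤s ())

  unbalanced⇒k≡1 : ∀ {k δ D Δ} → k ≤ δ → δ < D → D ≤ Δ → Δ ≤ k + 2 → (δ + D) * Δ ≡ 2 * (k + 2) * δ → k ≡ 1
  unbalanced⇒k≡1 {k} k≤δ δ<D D≤Δ Δ≤k+2 eq with m≤n⇒∃[o]m+o≡n k≤δ
  ... | a , refl with m≤n⇒∃[o]m+o≡n δ<D
  ... | b , refl with m≤n⇒∃[o]m+o≡n D≤Δ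
  ... | c , refl = unbalanced-offsets k a b c a+b+c≤1 eq
    where
    a+b+c≤1 : a + b + c ≤ 1
    a+b+c≤1 = +-cancelˡ-≤ (suc k) _ _ (subst₂ _≤_ (regroup k a b c) (+-suc k 1) Δ≤k+2)
      where
      regroup : ∀ k a b c → suc (k + a) + b + c ≡ suc k + (a + b + c)
      regroup = solve-∀

  k+2≢0 : ∀ k → NonZero (k + 2)
  k+2≢0 k = >-nonZero (<-≤-trans (s≤s z≤n) (m≤n+m 2 k))

  ι-+ : ∀ a b → ι (a + b) ≡ ι a ℚ.+ ι b
  ι-+ a b = ℚ.toℚᵘ-injective (ℚᵘ.≃-trans (ℚᵘ.*≡* eq) (ℚᵘ.≃-sym (ℚ.toℚᵘ-homo-+ (ι a) (ι b))))
    where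
    eq : ℤ.+ (a + b) ℤ.* ℤ.+ 1 ≡ (ℤ.+ a ℤ.* ℤ.+ 1 ℤ.+ ℤ.+ b ℤ.* ℤ.+ 1) ℤ.* ℤ.+ 1
    eq = trans (ℤ.*-identityʳ _) (trans (ℤ.pos-+ a b) (sym (trans (ℤ.*-identityʳ _)
           (cong₂ ℤ._+_ (ℤ.*-identityʳ (ℤ.+ a)) (ℤ.*-identityʳ (ℤ.+ b))))))

  ι-* : ∀ a b → ι (a * b) ≡ ι a ℚ.* ι b
  ι-* a b = ℚ.toℚᵘ-injective (ℚᵘ.≃-trans (ℚᵘ.*≡* eq) (ℚᵘ.≃-sym (ℚ.toℚᵘ-homo-* (ι a) (ι b))))
    where
    eq : ℤ.+ (a * b) ℤ.* ℤ.+ 1 ≡ (ℤ.+ a ℤ.* ℤ.+ b) ℤ.* ℤ.+ 1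
    eq = trans (ℤ.*-identityʳ _) (trans (ℤ.pos-* a b) (sym (ℤ.*-identityʳ _)))

  ι-≤⁻¹ : ∀ {a b} → ι a ℚ.≤ ι b → a ≤ b
  ι-≤⁻¹ (ℚ.*≤* le) = ℤ.drop‿+≤+ (subst₂ ℤ._≤_ (ℤ.*-identityʳ _) (ℤ.*-identityʳ _) le)

  ι-≢0 : ∀ c → .{{NonZero c}} → ι c ≢ ℚ.0ℚ
  ι-≢0 (suc c) ()

  ÷₀-≢0 : ∀ p q (q≢0 : q ≢ ℚ.0ℚ) → p ÷₀ q ≡ ℚ._÷_ p q {{ℚ.≢-nonZero q≢0}}
  ÷₀-≢0 p q q≢0 with q ℚ.≟ ℚ.0ℚ
  ... | yes q≡0 = ⊥-elim (q≢0 q≡0)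
  ... | no _    = refl

  -- The hypothesis of the theorem, with n − k − 2 = D, cleared of its denominator.
  zagreb-bound⇒ℕ : ∀ {n k D Δ δ e M} {{_ : NonZero δ}} {{_ : NonZero D}} → n ≡ D + (k + 2) →
    (ι n ℚ.- ι k ℚ.- ι 2) ℚ.* (ι Δ ℚ.* ι Δ)
      ℚ.+ ((ι e ℚ.* (ι δ ℚ.+ (ι n ℚ.- ι k ℚ.- ι 2))) ℚ.* (ι e ℚ.* (ι δ ℚ.+ (ι n ℚ.- ι k ℚ.- ι 2))))
        ÷₀ (ι 4 ℚ.* ι δ ℚ.* (ι n ℚ.- ι k ℚ.- ι 2) ℚ.* (ι k ℚ.+ ι 2))
      ℚ.≤ ι M →
    D * (Δ * Δ) * (4 * δ * D * (k + 2)) + (e * (δ + D)) * (e * (δ + D)) ≤ M * (4 * δ * D * (k + 2))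
  zagreb-bound⇒ℕ {k = k} {D} {Δ} {δ} {e} {M} refl bound =
    ι-≤⁻¹ (subst₂ ℚ._≤_ lhs≡ (sym (ι-* M c)) cleared)
    where
    DΔ² E² c : ℕ
    DΔ² = D * (Δ * Δ)
    E² = (e * (δ + D)) * (e * (δ + D))
    c = 4 * δ * D * (k + 2)

    instance
      c≢0 : NonZero c
      c≢0 = m*n≢0 (4 * δ * D) (k + 2) {{m*n≢0 (4 * δ) D {{m*n≢0 4 δ}}}} {{k+2≢0 k}}
      ιc≢0 : ℚ.NonZero (ι c)
      ιc≢0 = ℚ.≢-nonZero (ι-≢0 c)

    ιn-k-2≡ιD : ι (D + (k + 2)) ℚ.- ι k ℚ.- ι 2 ≡ ι D
    ιn-k-2≡ιD = trans (cong (λ z → z ℚ.- ι k ℚ.- ι 2) (trans (ι-+ D (k + 2)) (cong (ι D ℚ.+_) (ι-+ k 2))))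
                  (cancel (ι D) (ι k) (ι 2))
      where
      open +-*-Solver
      cancel : ∀ x y z → (x ℚ.+ (y ℚ.+ z)) ℚ.- y ℚ.- z ≡ x
      cancel = solve 3 (λ x y z → (x :+ (y :+ z)) :- y :- z := x) refl

    ιDΔ² : ι D ℚ.* (ι Δ ℚ.* ι Δ) ≡ ι DΔ²
    ιDΔ² = sym (trans (ι-* D (Δ * Δ)) (cong (ι D ℚ.*_) (ι-* Δ Δ)))

    ιE : ι e ℚ.* (ι δ ℚ.+ ι D) ≡ ι (e * (δ + D))
    ιE = sym (trans (ι-* e (δ + D)) (cong (ι e ℚ.*_) (ι-+ δ D)))

    ιE² : (ι e ℚ.* (ι δ ℚ.+ ι D)) ℚ.* (ι e ℚ.* (ι δ ℚ.+ ι D)) ≡ ι E²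
    ιE² = trans (cong₂ ℚ._*_ ιE ιE) (sym (ι-* (e * (δ + D)) (e * (δ + D))))

    ιc : ι 4 ℚ.* ι δ ℚ.* ι D ℚ.* (ι k ℚ.+ ι 2) ≡ ι c
    ιc = sym (trans (ι-* (4 * δ * D) (k + 2))
                    (cong₂ ℚ._*_ (trans (ι-* (4 * δ) D) (cong (ℚ._* ι D) (ι-* 4 δ))) (ι-+ k 2)))

    bound′ : ι DΔ² ℚ.+ ℚ._÷_ (ι E²) (ι c) ℚ.≤ ι M
    bound′ = subst (ℚ._≤ ι M) (cong₂ ℚ._+_ ιDΔ² (trans (cong₂ _÷₀_ ιE² ιc) (÷₀-≢0 (ι E²) (ι c) (ι-≢0 c))))
               (subst (λ z → z ℚ.* (ι Δ ℚ.* ι Δ)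
                               ℚ.+ ((ι e ℚ.* (ι δ ℚ.+ z)) ℚ.* (ι e ℚ.* (ι δ ℚ.+ z)))
                                 ÷₀ (ι 4 ℚ.* ι δ ℚ.* z ℚ.* (ι k ℚ.+ ι 2))
                               ℚ.≤ ι M)
                      ιn-k-2≡ιD bound)

    cleared : (ι DΔ² ℚ.+ ℚ._÷_ (ι E²) (ι c)) ℚ.* ι c ℚ.≤ ι M ℚ.* ι c
    cleared = ℚ.*-monoʳ-≤-nonNeg (ι c) bound′

    lhs≡ : (ι DΔ² ℚ.+ ℚ._÷_ (ι E²) (ι c)) ℚ.* ι c ≡ ι (DΔ² * c + E²)
    lhs≡ = begin
      (ι DΔ² ℚ.+ ℚ._÷_ (ι E²) (ι c)) ℚ.* ι c
        ≡⟨ ℚ.*-distribʳ-+ (ι c) (ι DΔ²) (ℚ._÷_ (ι E²) (ι c)) ⟩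
      ι DΔ² ℚ.* ι c ℚ.+ (ι E² ℚ.* ℚ.1/ ι c) ℚ.* ι c
        ≡⟨ cong (ι DΔ² ℚ.* ι c ℚ.+_) (ℚ.*-assoc (ι E²) (ℚ.1/ ι c) (ι c)) ⟩
      ι DΔ² ℚ.* ι c ℚ.+ ι E² ℚ.* (ℚ.1/ ι c ℚ.* ι c)
        ≡⟨ cong (λ z → ι DΔ² ℚ.* ι c ℚ.+ ι E² ℚ.* z) (ℚ.*-inverseˡ (ι c)) ⟩
      ι DΔ² ℚ.* ι c ℚ.+ ι E² ℚ.* ℚ.1ℚ
        ≡⟨ cong (ι DΔ² ℚ.* ι c ℚ.+_) (ℚ.*-identityʳ (ι E²)) ⟩
      ι DΔ² ℚ.* ι c ℚ.+ ι E²
        ≡⟨ trans (ι-+ (DΔ² * c) E²) (cong (ℚ._+ ι E²) (ι-* DΔ² c)) ⟨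
      ι (DΔ² * c + E²) ∎
      where open ≡-Reasoning

  module Bipartition {n : ℕ} (G : Graph n) (s : Fin n → Bool) (independent : IsIndependent G s) where

    I J : List (Fin n)
    I = filterᵗ s (allFin n)
    J = filterᵗ (not ∘ s) (allFin n)

    ∈I⁺ : ∀ {u} → s u ≡ true → u ∈ I
    ∈I⁺ {u} = ∈-filterᵗ⁺ s (∈-allFin u)

    ∈I⁻ : ∀ {u} → u ∈ I → s u ≡ true
    ∈I⁻ = proj₂ ∘ ∈-filterᵗ⁻ s {allFin n}

    ∈J⁺ : ∀ {u} → s u ≡ false → u ∈ J
    ∈J⁺ {u} su = ∈-filterᵗ⁺ (not ∘ s) (∈-allFin u) (cong not su)

    ∈J⁻ : ∀ {u} → u ∈ J → s u ≡ false
    ∈J⁻ = not-injective ∘ proj₂ ∘ ∈-filterᵗ⁻ (not ∘ s) {allFin n}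

    ∑-I+J : ∀ f → ∑ f (allFin n) ≡ ∑ f I + ∑ f J
    ∑-I+J f = ∑-filterᵗ s f (allFin n)

    private
      ∑-adjℕ≤length : ∀ u xs → ∑ (adjℕ G u) xs ≤ length xs
      ∑-adjℕ≤length u xs = ≤-trans (∑-mono-≤ xs (λ {v} _ → 𝟙≤1 (adj G u v)))
                                   (≤-reflexive (trans (∑-const 1 xs) (*-identityʳ (length xs))))

      ∑≡0 : ∀ xs {f : Fin n → ℕ} → (∀ {x} → x ∈ xs → f x ≡ 0) → ∑ f xs ≡ 0
      ∑≡0 xs f≡0 = trans (∑-cong xs f≡0) (trans (∑-const 0 xs) (*-zeroʳ (length xs)))

    deg-I : ∀ {u} → u ∈ I → deg G u ≡ ∑ (adjℕ G u) J
    deg-I {u} u∈I = begin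
      deg G u                               ≡⟨ deg≡∑adjℕ G u ⟩
      ∑ (adjℕ G u) (allFin n)               ≡⟨ ∑-I+J (adjℕ G u) ⟩
      ∑ (adjℕ G u) I + ∑ (adjℕ G u) J
        ≡⟨ cong (_+ ∑ (adjℕ G u) J) (∑≡0 I λ v∈I →
             cong 𝟙 (independent (∈I⁻ u∈I) (∈I⁻ v∈I))) ⟩
      ∑ (adjℕ G u) J ∎
      where open ≡-Reasoning

    deg-I≤|J| : ∀ {u} → u ∈ I → deg G u ≤ length J
    deg-I≤|J| {u} u∈I = subst (_≤ length J) (sym (deg-I u∈I)) (∑-adjℕ≤length u J)

    deg-I≡|J|⇒adjacent : ∀ {u} → u ∈ I → deg G u ≡ length J → ∀ {v} → v ∈ J → adj G u v ≡ true
    deg-I≡|J|⇒adjacent {u} u∈I deg≡ {v} v∈J with adj G u v | ∑-mono-≤-tight J (λ {w} _ → 𝟙≤1 (adj G u w))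
      (≤-reflexive (trans (trans (∑-const 1 J) (*-identityʳ (length J))) (trans (sym deg≡) (deg-I u∈I)))) v∈J
    ... | true | _ = refl

    -- The number of edges between I and J, counted from I.
    cut : ℕ
    cut = ∑ (deg G) I

    -- Twice the number of edges inside J.
    inner : ℕ
    inner = ∑ (λ u → ∑ (adjℕ G u) J) J

    ∑deg-J : ∑ (deg G) J ≡ cut + inner
    ∑deg-J = begin
      ∑ (deg G) J
        ≡⟨ ∑-cong J (λ {u} _ → trans (deg≡∑adjℕ G u) (∑-I+J (adjℕ G u))) ⟩
      ∑ (λ u → ∑ (adjℕ G u) I + ∑ (adjℕ G u) J) J
        ≡⟨ ∑-+ _ _ J ⟩
      ∑ (λ u → ∑ (adjℕ G u) I) J + inner
        ≡⟨ cong (_+ inner) (∑-comm (adjℕ G) J I) ⟩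
      ∑ (λ v → ∑ (λ u → adjℕ G u v) J) I + inner
        ≡⟨ cong (_+ inner) (∑-cong I λ {v} v∈I →
             trans (∑-cong J (λ {u} _ → cong 𝟙 (Graph.sym G u v))) (sym (deg-I v∈I))) ⟩
      cut + inner ∎
      where open ≡-Reasoning

    2e≡ : edges G + edges G ≡ cut + (cut + inner)
    2e≡ = trans (sym (handshake G)) (trans (∑-I+J (deg G)) (cong (cut +_) ∑deg-J))

    cut≤edges : cut ≤ edges G
    cut≤edges = *-cancelˡ-≤ 2 (begin
      2 * cut                ≡⟨ cong (cut +_) (+-identityʳ cut) ⟩
      cut + cut              ≤⟨ +-monoʳ-≤ cut (m≤m+n cut inner) ⟩
      cut + (cut + inner)    ≡⟨ 2e≡ ⟨
      edges G + edges G      ≡⟨ cong (edges G +_) (+-identityʳ (edges G)) ⟨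
      2 * edges G            ∎)
      where open ≤-Reasoning

    cut≡edges⇒inner≡0 : cut ≡ edges G → inner ≡ 0
    cut≡edges⇒inner≡0 cut≡e = +-cancelˡ-≡ cut _ _ (+-cancelˡ-≡ cut _ _ (begin
      cut + (cut + inner)  ≡⟨ 2e≡ ⟨
      edges G + edges G    ≡⟨ cong (λ x → x + x) cut≡e ⟨
      cut + cut            ≡⟨ cong (cut +_) (+-identityʳ cut) ⟨
      cut + (cut + 0)      ∎))
      where open ≡-Reasoning

    cut≡edges⇒J-independent : cut ≡ edges G → IsIndependent G (not ∘ s)
    cut≡edges⇒J-independent cut≡e {u} {v} u∈ v∈ with adj G u v
      | ∑≡0⇒≡0 (adjℕ G u) J
          (∑≡0⇒≡0 (λ u → ∑ (adjℕ G u) J) J (cut≡edges⇒inner≡0 cut≡e) (∈J⁺ (not-injective u∈)))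
          (∈J⁺ (not-injective v∈))
    ... | false | _ = refl

    deg-J≤|I| : IsIndependent G (not ∘ s) → ∀ {u} → u ∈ J → deg G u ≤ length I
    deg-J≤|I| J-independent {u} u∈J = begin
      deg G u
        ≡⟨ trans (deg≡∑adjℕ G u) (∑-I+J (adjℕ G u)) ⟩
      ∑ (adjℕ G u) I + ∑ (adjℕ G u) J
        ≡⟨ cong (∑ (adjℕ G u) I +_) (∑≡0 J λ v∈J →
             cong 𝟙 (J-independent (cong not (∈J⁻ u∈J)) (cong not (∈J⁻ v∈J)))) ⟩
      ∑ (adjℕ G u) I + 0
        ≤⟨ +-monoˡ-≤ 0 (∑-adjℕ≤length u I) ⟩
      length I + 0
        ≡⟨ +-identityʳ (length I) ⟩
      length I ∎
      where open ≤-Reasoning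

    deg² : Fin n → ℕ
    deg² u = deg G u * deg G u

    M₁≡ : M₁ G ≡ ∑ deg² I + ∑ deg² J
    M₁≡ = trans (M₁≡∑deg² G) (∑-I+J deg²)

    ∑-const-on : ∀ xs c → (∀ {u} → u ∈ xs → deg G u ≡ c) → ∑ (deg G) xs ≡ length xs * c
    ∑-const-on xs c deg≡c = trans (∑-cong xs deg≡c) (∑-const c xs)

    private
      deg²≤Δ² : ∀ {u} → u ∈ J → deg² u ≤ maxDeg G * maxDeg G
      deg²≤Δ² {u} _ = *-mono-≤ (deg≤maxDeg G u) (deg≤maxDeg G u)

    ∑deg²-J≤ : ∑ deg² J ≤ length J * (maxDeg G * maxDeg G)
    ∑deg²-J≤ = ≤-trans (∑-mono-≤ J deg²≤Δ²) (≤-reflexive (∑-const _ J))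

    ∑deg²-J≡⇒ : ∑ deg² J ≡ length J * (maxDeg G * maxDeg G) → ∀ {u} → u ∈ J → deg G u ≡ maxDeg G
    ∑deg²-J≡⇒ tight u∈J =
      *-square-injective (∑-mono-≤-tight J deg²≤Δ² (≤-reflexive (trans (∑-const _ J) (sym tight))) u∈J)

    module _ {δ} (δ≤deg : ∀ u → δ ≤ deg G u) where

      private
        D = length J
        deg²+δD≤ : ∀ {u} → u ∈ I → deg² u + δ * D ≤ (δ + D) * deg G u
        deg²+δD≤ u∈I = sq+δD≤[δ+D]* (δ≤deg _) (deg-I≤|J| u∈I)
        ∑≡ : ∑ (λ u → deg² u + δ * D) I ≡ ∑ deg² I + length I * (δ * D)
        ∑≡ = trans (∑-+ deg² _ I) (cong (∑ deg² I +_) (∑-const (δ * D) I))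
        ∑≡′ : ∑ (λ u → (δ + D) * deg G u) I ≡ (δ + D) * cut
        ∑≡′ = ∑-*ˡ (δ + D) (deg G) I

      ∑deg²-I≤ : ∑ deg² I + length I * (δ * D) ≤ (δ + D) * cut
      ∑deg²-I≤ = subst₂ _≤_ ∑≡ ∑≡′ (∑-mono-≤ I deg²+δD≤)

      ∑deg²-I≡⇒ : ∑ deg² I + length I * (δ * D) ≡ (δ + D) * cut → ∀ {u} → u ∈ I → deg G u ≡ δ ⊎ deg G u ≡ D
      ∑deg²-I≡⇒ tight u∈I = sq+δD≡[δ+D]*⇒ (δ≤deg _) (deg-I≤|J| u∈I)
        (∑-mono-≤-tight I deg²+δD≤ (≤-reflexive (trans ∑≡′ (trans (sym tight) (sym ∑≡)))) u∈I)

  module Extremal {n k : ℕ} {G : Graph n} (k≥1 : k ≥ 1) (connected : KConnected k G)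
                  (independent-set : IndependentSet G (k + 2)) where

    open IndependentSet independent-set
    open Bipartition G member independent

    D Δ δ m : ℕ
    D = length J
    Δ = maxDeg G
    δ = minDeg G
    m = k + 2

    |I|≡m : length I ≡ m
    |I|≡m = trans (length-filterᵗ member (allFin n)) size

    n≡D+m : n ≡ D + m
    n≡D+m = begin
      n                                                     ≡⟨ length-allFin n ⟨
      length (allFin n)                                     ≡⟨ count+count-not member (allFin n) ⟨
      count member (allFin n) + count (not ∘ member) (allFin n)
        ≡⟨ cong₂ _+_ size (sym (length-filterᵗ _ (allFin n))) ⟩
      m + D                                                 ≡⟨ +-comm m D ⟩
      D + m                                                 ∎
      where open ≡-Reasoning

    k≤D : k ≤ D
    k≤D with two-members (m≤n+m 2 k)
    ... | u , v , u∈ , v∈ , u≢v =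
      subst (k ≤_) (sym (length-filterᵗ _ (allFin n))) (k≤count-complement G connected independent u∈ v∈ u≢v)

    k≤δ : k ≤ δ
    k≤δ = k≤minDeg G connected

    instance
      δ≢0 : NonZero δ
      δ≢0 = >-nonZero (≤-trans k≥1 k≤δ)
      D≢0 : NonZero D
      D≢0 = >-nonZero (≤-trans k≥1 k≤D)
      m≢0 : NonZero m
      m≢0 = k+2≢0 k

    some-I : ∃ λ i → i ∈ I
    some-I with I | trans |I|≡m (+-comm k 2)
    ... | i ∷ _ | _ = i , here refl

    some-J : ∃ λ j → j ∈ J
    some-J with J | ≤-trans k≥1 k≤D
    ... | j ∷ _ | _ = j , here refl

    δ≤D : δ ≤ D
    δ≤D = ≤-trans (minDeg≤deg G (proj₁ some-I)) (deg-I≤|J| (proj₂ some-I))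

    ZagrebBound : Set
    ZagrebBound = D * (Δ * Δ) * (4 * δ * D * m) + (edges G * (δ + D)) * (edges G * (δ + D))
                  ≤ M₁ G * (4 * δ * D * m)

    module _ (bound : ZagrebBound) where

      open TightEstimates {MI = ∑ deg² I} {MJ = ∑ deg² J} {D} {Δ} {m} {δ} {cut} {edges G}
        ∑deg²-J≤ (subst (λ z → ∑ deg² I + z * (δ * D) ≤ (δ + D) * cut) |I|≡m (∑deg²-I≤ (minDeg≤deg G)))
        cut≤edges (subst (λ z → D * (Δ * Δ) * (4 * δ * D * m) + (edges G * (δ + D)) * (edges G * (δ + D))
                                ≤ z * (4 * δ * D * m)) M₁≡ bound)

      deg-J≡Δ : ∀ {u} → u ∈ J → deg G u ≡ Δ
      deg-J≡Δ = ∑deg²-J≡⇒ MJ≡DΔ²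

      deg-I≡δ⊎D : ∀ {u} → u ∈ I → deg G u ≡ δ ⊎ deg G u ≡ D
      deg-I≡δ⊎D = ∑deg²-I≡⇒ (minDeg≤deg G)
        (trans (cong (λ z → ∑ deg² I + z * (δ * D)) |I|≡m) MI+mδD≡[δ+D]S)

      J-independent : IsIndependent G (not ∘ member)
      J-independent = cut≡edges⇒J-independent S≡e

      -- Counting the edges between I and J from J.
      cut≡DΔ : cut ≡ D * Δ
      cut≡DΔ = begin
        cut                ≡⟨ +-identityʳ cut ⟨
        cut + 0            ≡⟨ cong (cut +_) (cut≡edges⇒inner≡0 S≡e) ⟨
        cut + inner        ≡⟨ ∑deg-J ⟨
        ∑ (deg G) J        ≡⟨ ∑-const-on J Δ deg-J≡Δ ⟩
        D * Δ              ∎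
        where open ≡-Reasoning

      [δ+D]Δ≡2mδ : (δ + D) * Δ ≡ 2 * m * δ
      [δ+D]Δ≡2mδ = *-cancelʳ-≡ _ _ D (begin
        (δ + D) * Δ * D         ≡⟨ rearrange δ D Δ ⟩
        (δ + D) * (D * Δ)       ≡⟨ cong ((δ + D) *_) cut≡DΔ ⟨
        (δ + D) * cut           ≡⟨ [δ+D]S≡2mδD ⟩
        2 * (m * (δ * D))       ≡⟨ rearrange′ m δ D ⟩
        2 * m * δ * D           ∎)
        where
        open ≡-Reasoning
        rearrange : ∀ δ D Δ → (δ + D) * Δ * D ≡ (δ + D) * (D * Δ)
        rearrange = solve-∀
        rearrange′ : ∀ m δ D → 2 * (m * (δ * D)) ≡ 2 * m * δ * D
        rearrange′ = solve-∀

      Δ≤m : Δ ≤ m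
      Δ≤m = subst₂ _≤_ (deg-J≡Δ (proj₂ some-J)) |I|≡m (deg-J≤|I| J-independent (proj₂ some-J))

      δ≤Δ : δ ≤ Δ
      δ≤Δ = subst (δ ≤_) (deg-J≡Δ (proj₂ some-J)) (minDeg≤deg G (proj₁ some-J))

      -- If Δ < D then all degrees in I equal δ, and the edge count gives δ = D.
      D≤Δ : D ≤ Δ
      D≤Δ with D ≤? Δ
      ... | yes D≤Δ = D≤Δ
      ... | no D≰Δ = ⊥-elim (<-irrefl δ≡D (≤-<-trans δ≤Δ (≰⇒> D≰Δ)))
        where
        deg-I≡δ : ∀ {u} → u ∈ I → deg G u ≡ δ
        deg-I≡δ u∈I with deg-I≡δ⊎D u∈I
        ... | inj₁ deg≡δ = deg≡δ
        ... | inj₂ deg≡D = ⊥-elim (D≰Δ (subst (_≤ Δ) deg≡D (deg≤maxDeg G _)))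
        cut≡mδ : cut ≡ m * δ
        cut≡mδ = trans (∑-const-on I δ deg-I≡δ) (cong (_* δ) |I|≡m)
        δ≡D : δ ≡ D
        δ≡D = +-cancelʳ-≡ D δ D (*-cancelʳ-≡ (δ + D) (D + D) (m * δ) {{m*n≢0 m δ}} (begin
          (δ + D) * (m * δ)       ≡⟨ cong ((δ + D) *_) cut≡mδ ⟨
          (δ + D) * cut           ≡⟨ [δ+D]S≡2mδD ⟩
          2 * (m * (δ * D))       ≡⟨ rearrange m δ D ⟩
          (D + D) * (m * δ)       ∎))
          where
          open ≡-Reasoning
          rearrange : ∀ m δ D → 2 * (m * (δ * D)) ≡ (D + D) * (m * δ)
          rearrange = solve-∀

      module _ (9≤n : 9 ≤ n) where

        -- If δ < D, the equation (δ + D)Δ = 2mδ forces k = 1, so n = D + m ≤ 2m = 6.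
        δ≡D : δ ≡ D
        δ≡D with m≤n⇒m<n∨m≡n δ≤D
        ... | inj₂ δ≡D = δ≡D
        ... | inj₁ δ<D = ⊥-elim (≤⇒≯ n≤6 (≤-trans (m≤n+m 7 2) 9≤n))
          where
          n≤6 : n ≤ 6
          n≤6 = subst (λ z → n ≤ z + 2 + (z + 2)) (unbalanced⇒k≡1 k≤δ δ<D D≤Δ Δ≤m [δ+D]Δ≡2mδ)
                  (subst (_≤ m + m) (sym n≡D+m) (+-monoˡ-≤ m (≤-trans D≤Δ Δ≤m)))

        I-J-adjacent : ∀ {u v} → member u ≡ true → member v ≡ false → adj G u v ≡ true
        I-J-adjacent {u} u∈ v∈ = deg-I≡|J|⇒adjacent (∈I⁺ u∈) deg≡D (∈J⁺ v∈)
          where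
          deg≡D : deg G u ≡ D
          deg≡D with deg-I≡δ⊎D (∈I⁺ u∈)
          ... | inj₁ deg≡δ = trans deg≡δ δ≡D
          ... | inj₂ deg≡D = deg≡D

        complete-bipartite : ∀ u v → adj G u v ≡ (member u xor member v)
        complete-bipartite u v with member u in u∈ | member v in v∈
        ... | true  | true  = independent u∈ v∈
        ... | false | false = J-independent (cong not u∈) (cong not v∈)
        ... | true  | false = I-J-adjacent u∈ v∈
        ... | false | true  = trans (Graph.sym G u v) (I-J-adjacent v∈ u∈)

        D≤m : D ≤ m
        D≤m = subst (_≤ m) δ≡D (≤-trans δ≤Δ Δ≤m)

  interleave-↭ : ∀ {A : Set} (xs ys : List A) → interleave xs ys ↭ xs ++ ys
  interleave-↭ []       ys = ↭-refl
  interleave-↭ (x ∷ xs) ys = prep x (↭-trans (interleave-↭ ys xs) (++-comm ys xs))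

  module CompleteBipartite {n : ℕ} (G : Graph n) (s : Fin n → Bool)
                           (adj≡xor : ∀ u v → adj G u v ≡ (s u xor s v)) where

    open Bipartition G s (λ {u} {v} su sv → trans (adj≡xor u v) (cong₂ _xor_ su sv))
      using (I; J; ∈I⁺; ∈I⁻; ∈J⁺; ∈J⁻)

    private
      I-J-adjacent : ∀ {u v} → u ∈ I → v ∈ J → adj G u v ≡ true
      I-J-adjacent u∈I v∈J = trans (adj≡xor _ _) (cong₂ _xor_ (∈I⁻ u∈I) (∈J⁻ v∈J))

      !I++J : Unique (I ++ J)
      !I++J = ++⁺ (filterᵗ-unique s (allFin⁺ n)) (filterᵗ-unique (not ∘ s) (allFin⁺ n))
                λ (u∈I , u∈J) → case (trans (sym (∈I⁻ u∈I)) (∈J⁻ u∈J))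
        where
        case : true ≢ false
        case ()

      |I++J|≡n : length (I ++ J) ≡ n
      |I++J|≡n = trans (length-++ I)
                   (trans (cong₂ _+_ (length-filterᵗ s (allFin n)) (length-filterᵗ _ (allFin n)))
                     (trans (count+count-not s (allFin n)) (length-allFin n)))

    IsWalk-interleave : ∀ xs ys → (∀ {x y} → x ∈ xs → y ∈ ys → adj G x y ≡ true) →
                        length ys ≤ length xs → length xs ≤ suc (length ys) → IsWalk G (interleave xs ys)
    IsWalk-interleave []           []       _        _         _          = tt
    IsWalk-interleave (x ∷ [])     []       _        _         _          = tt
    IsWalk-interleave (x ∷ _ ∷ _)  []       _        _         (s≤s ())
    IsWalk-interleave (x ∷ xs)     (y ∷ ys) adjacent (s≤s ys≤) (s≤s xs≤) =
      adjacent (here refl) (here refl) ,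
      IsWalk-interleave (y ∷ ys) xs (λ y∈ x∈ → trans (Graph.sym G _ _) (adjacent (there x∈) y∈)) xs≤ (s≤s ys≤)

    traceable : length J ≤ length I → length I ≤ suc (length J) → Traceable G
    traceable J≤I I≤J+1 =
      interleave I J ,
      IsWalk-interleave I J I-J-adjacent J≤I I≤J+1 ,
      Unique-resp-↭ (↭-sym (interleave-↭ I J)) !I++J ,
      trans (↭-length (interleave-↭ I J)) |I++J|≡n

    module _ {k} (|J|≡k : length J ≡ k) (|I|≡k+2 : length I ≡ k + 2) where

      private
        L : List (Fin n)
        L = J ++ I

        |L|≡ : length L ≡ k + (k + 2)
        |L|≡ = trans (length-++ J) (cong₂ _+_ |J|≡k |I|≡k+2)

        !L : Unique L
        !L = Unique-resp-↭ (++-comm I J) !I++J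

        ∈L′ : ∀ u b → s u ≡ b → u ∈ L
        ∈L′ u true  su = ∈-++⁺ʳ J (∈I⁺ su)
        ∈L′ u false su = ∈-++⁺ˡ (∈J⁺ su)

        ∈L : ∀ u → u ∈ L
        ∈L u = ∈L′ u (s u) refl

        index-∈-++⁺ˡ : ∀ {u} {xs ys : List (Fin n)} (u∈ : u ∈ xs) →
                       toℕ (index (∈-++⁺ˡ {ys = ys} u∈)) ≡ toℕ (index u∈)
        index-∈-++⁺ˡ (here _)  = refl
        index-∈-++⁺ˡ (there p) = cong suc (index-∈-++⁺ˡ p)

        index-∈-++⁺ʳ : ∀ {u} xs {ys : List (Fin n)} (u∈ : u ∈ ys) →
                       toℕ (index (∈-++⁺ʳ xs u∈)) ≡ length xs + toℕ (index u∈)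
        index-∈-++⁺ʳ []       _  = refl
        index-∈-++⁺ʳ (_ ∷ xs) u∈ = cong suc (index-∈-++⁺ʳ xs u∈)

        index-∈-lookup : ∀ (xs : List (Fin n)) i → index (∈-lookup {xs = xs} i) ≡ i
        index-∈-lookup (_ ∷ _)  Fin.zero    = refl
        index-∈-lookup (_ ∷ xs) (Fin.suc i) = cong Fin.suc (index-∈-lookup xs i)

        ∈L-irrelevant : ∀ {u} (p q : u ∈ L) → p ≡ q
        ∈L-irrelevant =
          SetoidMembership.unique⇒irrelevant (setoid (Fin n)) (Decidable⇒UIP.≡-irrelevant _≟ᶠ_) !L

        to : Fin n → Fin (k + (k + 2))
        to u = cast |L|≡ (index (∈L u))

        from : Fin (k + (k + 2)) → Fin n
        from i = lookup L (cast (sym |L|≡) i)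

        to∘from : ∀ i → to (from i) ≡ i
        to∘from i = trans (cong (cast |L|≡) (trans (cong index (∈L-irrelevant _ (∈-lookup _)))
                                                    (index-∈-lookup L (cast (sym |L|≡) i))))
                          (cast-involutive |L|≡ (sym |L|≡) i)

        from∘to : ∀ u → from (to u) ≡ u
        from∘to u = trans (cong (lookup L) (cast-involutive (sym |L|≡) |L|≡ (index (∈L u))))
                          (sym (lookup-index (∈L u)))

        -- J is sent to the first k positions, the side of size k in K k (k + 2).
        side : ∀ u → (toℕ (to u) <ᵇ k) ≡ not (s u)
        side u = trans (cong (_<ᵇ k) (toℕ-cast |L|≡ (index (∈L u)))) (side′ (s u) refl)
          where
          side′ : ∀ b (su : s u ≡ b) → (toℕ (index (∈L′ u b su)) <ᵇ k) ≡ not b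
          side′ true  su = <ᵇ-false λ i<k → m+n≮m k (toℕ (index (∈I⁺ su)))
            (subst (_< k) (trans (index-∈-++⁺ʳ J (∈I⁺ su)) (cong (_+ toℕ (index (∈I⁺ su))) |J|≡k)) i<k)
          side′ false su = <ᵇ-true (subst (_< k) (sym (index-∈-++⁺ˡ (∈J⁺ su)))
                                     (subst (toℕ (index (∈J⁺ su)) <_) |J|≡k (toℕ<n (index (∈J⁺ su)))))

      ≅K : G ≅ K k (k + 2)
      ≅K = mk↔ₛ′ to from to∘from from∘to , λ u v →
        trans (cong₂ _xor_ (side u) (side v)) (trans (not-xor-not (s u) (s v)) (sym (adj≡xor u v)))
        where
        not-xor-not : ∀ a b → (not a xor not b) ≡ (a xor b)
        not-xor-not true  b = refl
        not-xor-not false b = not-involutive b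

    traceable-or-≅K : ∀ {k} → length I ≡ k + 2 → k ≤ length J → length J ≤ k + 2 →
                      Traceable G ⊎ G ≅ K k (k + 2)
    traceable-or-≅K {k} |I|≡k+2 k≤|J| |J|≤k+2 with m≤n⇒∃[o]m+o≡n k≤|J|
    ... | 0 , k+0≡|J| = inj₂ (≅K (trans (sym k+0≡|J|) (+-identityʳ k)) |I|≡k+2)
    ... | 1 , k+1≡|J| = inj₁ (traceable (subst₂ _≤_ k+1≡|J| (sym |I|≡k+2) (+-monoʳ-≤ k (s≤s z≤n)))
                                       (subst₂ _≤_ (sym |I|≡k+2) (cong suc k+1≡|J|) (≤-reflexive (+-suc k 1))))
    ... | 2 , k+2≡|J| = inj₁ (traceable (≤-reflexive (trans (sym k+2≡|J|) (sym |I|≡k+2)))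
                                       (≤-trans (≤-reflexive (trans |I|≡k+2 k+2≡|J|)) (n≤1+n _)))
    ... | suc (suc (suc t)) , k+3+t≡|J| =
      ⊥-elim (≤⇒≯ |J|≤k+2 (subst (k + 2 <_) k+3+t≡|J| (+-monoʳ-< k (s≤s (s≤s (s≤s z≤n))))))

open import Data.Nat using (ℕ; _≥_; _+_)
open import Data.Sum using (_⊎_; inj₁; inj₂)
open import Data.Rational using (_≤_; _*_; _-_)
open import Data.Rational using () renaming (_+_ to _+ℚ_)

theorem2 : (k n : ℕ) → k ≥ 1 → n ≥ 9 → (G : Graph n) → KConnected k G →
    (ι n - ι k - ι 2) * (ι (maxDeg G) * ι (maxDeg G))
      +ℚ ((ι (edges G) * (ι (minDeg G) +ℚ (ι n - ι k - ι 2)))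
            * (ι (edges G) * (ι (minDeg G) +ℚ (ι n - ι k - ι 2))))
         ÷₀ (ι 4 * ι (minDeg G) * (ι n - ι k - ι 2) * (ι k +ℚ ι 2))
      ≤ ι (M₁ G) →
    Traceable G ⊎ (G ≅ K k (k + 2))
theorem2 k n k≥1 n≥9 G connected bound with traceable-or-independent G connected
... | inj₁ traceable       = inj₁ traceable
... | inj₂ independent-set = traceable-or-≅K |I|≡m k≤D (D≤m cleared n≥9)
  where
  open IndependentSet independent-set using (member)
  open Extremal k≥1 connected independent-set
  cleared : ZagrebBound
  cleared = zagreb-bound⇒ℕ {Δ = Δ} {e = edges G} {M = M₁ G} n≡D+m bound
  open CompleteBipartite G member (complete-bipartite cleared n≥9)
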